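{- (i) $P_{132,21}(x) = \dfrac{1}{1-x}$. (ii) $P_{132,312}(x) = \dfrac{(1-x-x^2)(1-x)+x(1+x)}{(1-x)^2}$. (iii) For all $d \ge 4$, with $\tau = d\,1\,2\ldots(d-1)$, $$P_{132,\tau}(x) = \frac{(1-x)(1-x-x^2)^{d-2} + (1-x^2)\sum_{r=0}^{d-4}(1-x-x^2)^{r+1}x^{d-3-r} + x^{d-2}(1+x)}{(1-x)^2(1-x-x^2)^{d-3}}.$$
   Context: $S_n$ is the set of permutations of $\{1,\dots,n\}$ in one-line notation. A permutation avoids a pattern $\sigma\in S_k$ if it has no subsequence of length $k$ whose entries are in the same relative order as $\sigma$. $\mathcal{P}_n(132)$ is the set of permutations in $S_n$ avoiding each of $132$, $2341$, $3241$ (equivalently, the two-stack sortable permutations avoiding $132$), and $\mathcal{P}_0(132)$ contains only the empty permutation. For a pattern $\tau$, $\mathcal{P}_n(132,\tau)$ is the set of elements of $\mathcal{P}_n(132)$ that also avoid $\tau$, and $P_{132,\tau}(x)=\sum_{n\ge 0}|\mathcal{P}_n(132,\tau)|x^n$. The pattern $d\,1\,2\ldots(d-1)$ is the permutation of length $d$ whose first entry is $d$ followed by $1,2,\dots,d-1$ in increasing order. -}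

module Defs where

open import Data.Bool using (Bool; true; false; _∧_; _∨_; not; if_then_else_)
open import Data.Nat as ℕ using (ℕ; zero; suc; _∸_; _<ᵇ_)
open import Data.Integer as ℤ using (ℤ; +_; -_)
open import Data.List using (List; []; _∷_; map; concatMap; filterᵇ; length; zipWith; reverse; upTo)
open import Data.Product using (_×_; _,_)
open import Relation.Nullary.Decidable using (does)
open import Relation.Binary.PropositionalEquality using (_≡_)
open import Relation.Unary using (Pred)
import Data.Bool.Properties
open import Data.Bool.ListAction using (all; any)

insertions : ℕ → List ℕ → List (List ℕ)
insertions x []       = (x ∷ []) ∷ []
insertions x (y ∷ ys) = (x ∷ y ∷ ys) ∷ map (y ∷_) (insertions x ys)

-- S n : the list of all permutations of {1,…,n} (each exactly once),
-- obtained by inserting n into every position of every element of S (n-1).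
S : ℕ → List (List ℕ)
S zero    = [] ∷ []
S (suc n) = concatMap (insertions (suc n)) (S n)

subseqs : ℕ → List ℕ → List (List ℕ)
subseqs zero    _        = [] ∷ []
subseqs (suc k) []       = []
subseqs (suc k) (x ∷ xs) = map (x ∷_) (subseqs k xs) ++' subseqs (suc k) xs
  where
  _++'_ : List (List ℕ) → List (List ℕ) → List (List ℕ)
  [] ++' ys = ys
  (a ∷ as) ++' ys = a ∷ (as ++' ys)

sameOrder : List ℕ → List ℕ → Bool
sameOrder [] [] = true
sameOrder (a ∷ as) (b ∷ bs) =
  all (λ p → agree p) (pairs as bs) ∧ sameOrder as bs
  where
  pairs : List ℕ → List ℕ → List (ℕ × ℕ)
  pairs (x ∷ xs) (y ∷ ys) = (x , y) ∷ pairs xs ys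
  pairs _ _ = []
  eqb : Bool → Bool → Bool
  eqb true true = true
  eqb false false = true
  eqb _ _ = false
  agree : ℕ × ℕ → Bool
  agree (x , y) = eqb (a <ᵇ x) (b <ᵇ y) ∧ eqb (x <ᵇ a) (y <ᵇ b)
sameOrder _ _ = false

contains : List ℕ → List ℕ → Bool
contains σ π = any (sameOrder σ) (subseqs (length σ) π)

avoids : List ℕ → List ℕ → Bool
avoids σ π = not (contains σ π)

inP132 : List ℕ → Bool
inP132 π = avoids (1 ∷ 3 ∷ 2 ∷ []) π ∧ avoids (2 ∷ 3 ∷ 4 ∷ 1 ∷ []) π
         ∧ avoids (3 ∷ 2 ∷ 4 ∷ 1 ∷ []) π

countP : List ℕ → ℕ → ℕ
countP τ n = length (filterᵇ (λ π → inP132 π ∧ avoids τ π) (S n))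

dPattern : ℕ → List ℕ
dPattern d = d ∷ map suc (upTo (d ∸ 1))

-- Polynomials with integer coefficients (coefficient lists, constant first)

Poly : Set
Poly = List ℤ

infixl 6 _⊕_
infixl 7 _⊗_
infixr 8 _^ᴾ_

_⊕_ : Poly → Poly → Poly
[]       ⊕ q        = q
(a ∷ p)  ⊕ []       = a ∷ p
(a ∷ p)  ⊕ (b ∷ q)  = (a ℤ.+ b) ∷ (p ⊕ q)

_⊗_ : Poly → Poly → Poly
[]      ⊗ q = []
(a ∷ p) ⊗ q = map (a ℤ.*_) q ⊕ (+ 0 ∷ (p ⊗ q))

𝟙 : Poly
𝟙 = + 1 ∷ []

X : Poly
X = + 0 ∷ + 1 ∷ []

negP : Poly → Poly
negP = map (-_)

_^ᴾ_ : Poly → ℕ → Poly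
p ^ᴾ zero  = 𝟙
p ^ᴾ suc k = p ⊗ (p ^ᴾ k)

sumP : ℕ → (ℕ → Poly) → Poly
sumP zero    f = []
sumP (suc m) f = sumP m f ⊕ f m

coeff : Poly → ℕ → ℤ
coeff []      _       = + 0
coeff (a ∷ p) zero    = a
coeff (a ∷ p) (suc n) = coeff p n

Series : Set
Series = ℕ → ℤ

sumTo : ℕ → (ℕ → ℤ) → ℤ
sumTo zero    g = g 0
sumTo (suc n) g = sumTo n g ℤ.+ g (suc n)

_·ₛ_ : Poly → Series → Series
(p ·ₛ f) n = sumTo n (λ i → coeff p i ℤ.* f (n ∸ i))

-- "the series f equals N(x)/D(x)" , i.e. D(x)·f(x) = N(x) as formal
-- power series (D has constant term ±1, so this determines f uniquely)
_≡N/D_ : Series → Poly × Poly → Set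
f ≡N/D (N , D) = ∀ n → (D ·ₛ f) n ≡ coeff N n

genP : List ℕ → Series
genP τ n = + countP τ n

{-# OPTIONS --safe #-}
module Submission where

-- A permutation in 𝒫_{n+1}(132) arises from one in 𝒫_n(132) by inserting the largest entry, and
-- only three positions avoid creating a 132, 2341 or 3241: the front, the end, and right after a
-- first entry exceeding all later ones.  Following what each insertion does to occurrences of
-- τ = d12…(d−1) and of 12…i gives, for T = P_{132,τ} and G_i = P_{132,12…i},
--   (1−x) T = 1 + (x+x²)(G_{d−1} − 1),     G₁ = 1,     (1−x) G₂ = 1,
--   (1−x−x²) G_{i+1} = 1−x−x² + x G_i   (i ≥ 2).
-- Unrolling the last recurrence gives x (1−x−x²)^k (1−x) G_{k+2} = (1−x) Q_k + x^{k+1} with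
-- Q_k = Σ_{r<k} (1−x−x²)^{r+1} x^{k−r}, and substituting this into the first equation yields (i)–(iii).

open import Defs
open import Data.Bool as Bool using (Bool; true; false; T; _∧_; not)
open import Data.Bool.ListAction using (all)
open import Data.Bool.Properties using (T-∧; T-≡; ∧-zeroʳ)
open import Data.Integer as ℤ using (ℤ; +_)
import Data.Integer.Properties as ℤ
import Data.Integer.Solver as ℤ-Solver
open import Data.List as List
  using (List; []; _∷_; _++_; [_]; map; zip; length; upTo; applyDownFrom; concatMap; initLast; _∷ʳ′_; filterᵇ)
open import Data.List.Properties
  using (length-++; map-++; map-∘; map-cong; ++-assoc; upTo-∷ʳ; length-applyDownFrom)
open import Data.List.Relation.Binary.Permutation.Propositional
  using (_↭_; ↭-refl; ↭-prep; ↭-swap; ↭-trans; ↭-sym; ↭⇒↭ₛ)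
open import Data.List.Relation.Binary.Permutation.Propositional.Properties using (All-resp-↭; ↭-length)
open import Data.List.Relation.Binary.Pointwise as Pointwise using (Pointwise; []; _∷_)
open import Data.List.Relation.Binary.Pointwise.Properties using (Pointwise-length)
open import Data.List.Relation.Binary.Sublist.Propositional using (_⊆_; []; _∷_; _∷ʳ_; minimum; ⊆-refl; ⊆-trans)
open import Data.List.Relation.Binary.Sublist.Propositional.Properties using (All-resp-⊆; ∷ˡ⁻; ++⁺; ++⁺ʳ; ++⁺ˡ)
open import Data.List.Relation.Unary.All as All using (All; []; _∷_)
open import Data.List.Relation.Unary.All.Properties
  using (All¬⇒¬Any; applyUpTo⁺₁; applyDownFrom⁺₁; map⁺; all⁺; all⁻; ++⁻ʳ; concat⁺)
open import Data.List.Relation.Unary.AllPairs using ([]; _∷_)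
import Data.List.Relation.Unary.AllPairs.Properties as AllPairs
open import Data.List.Relation.Unary.Any using (Any; here; there)
import Data.List.Relation.Unary.Any.Properties as Any
open import Data.List.Relation.Unary.Unique.Propositional using (Unique)
open import Data.Nat using (ℕ; zero; suc; _+_; _∸_; _<_; _≤_; _<ᵇ_; z≤n; s≤s; z<s; s<s)
open import Data.Nat.Properties
  using ( <ᵇ⇒<; <⇒<ᵇ; suc-injective; <⇒≤; ≤⇒≯; <⇒≯; ≮⇒≥; ≤∧≢⇒<; <-irrefl; <-asym; <-trans; <-cmp
        ; n<1+n; m<n⇒m<1+n; +-comm; +-assoc; +-identityʳ; +-∸-assoc; m+n∸n≡m )
open import Data.Nat.Solver using (module +-*-Solver)
open import Data.Product using (∃-syntax; _×_; _,_; proj₁; proj₂)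
open import Data.Sum using (_⊎_; inj₁; inj₂; [_,_]′)
open import Data.Unit using (tt)
open import Function.Base using (_∘_)
open import Function.Bundles using (_⇔_; mk⇔; Equivalence)
open import Relation.Binary.Definitions using (tri<; tri≈; tri>)
open import Relation.Binary.PropositionalEquality
  using (_≡_; _≢_; _≗_; refl; sym; trans; cong; cong₂; subst; setoid; _→-setoid_; module ≡-Reasoning)
open import Data.List.Relation.Binary.Permutation.Setoid.Properties (setoid ℕ) using (Unique-resp-↭)
import Relation.Binary.Reasoning.Setoid as SetoidReasoning
open import Relation.Nullary.Decidable using (does; yes; no)
open import Relation.Nullary.Negation using (¬_; contradiction)

variable
  a b s t x y m h k : ℕ
  σ c π : List ℕ

-- subseqs and sameOrder are built from helpers bound in where-blocks of Defs, which cannot be named.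
-- The metavariables appendʷ and agreeAndʷ are solved by unification as (combinations of) these
-- helpers, taking the module parameters of the where-block as extra arguments.
private
  mutual
    appendʷ : ℕ → ℕ → List ℕ → List (List ℕ) → List (List ℕ) → List (List ℕ)
    appendʷ = _

    subseqs-∷ʷ : ∀ k x xs →
      subseqs (suc k) (x ∷ xs) ≡ appendʷ k x xs (map (x ∷_) (subseqs k xs)) (subseqs (suc k) xs)
    subseqs-∷ʷ k x xs with map (List._∷_ x) (subseqs k xs) | subseqs (suc k) xs
    ... | _ | _ = refl

  appendʷ≡++ : ∀ k x xs as bs → appendʷ k x xs as bs ≡ as ++ bs
  appendʷ≡++ k x xs []       bs = refl
  appendʷ≡++ k x xs (a ∷ as) bs = cong (a ∷_) (appendʷ≡++ k x xs as bs)

  mutual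
    agreeAndʷ : ℕ → List ℕ → ℕ → List ℕ → List ℕ → List ℕ → Bool → Bool
    agreeAndʷ = _

    -- The hypotheses only serve to make the first comparison compute, so that afterwards the
    -- helpers are applied to variables alone.
    agreeAndʷ-solution : ∀ a x xs b y ys →
      (a <ᵇ x) ≡ true → (b <ᵇ y) ≡ true → (x <ᵇ a) ≡ false → (y <ᵇ b) ≡ false →
      sameOrder (a ∷ x ∷ xs) (b ∷ y ∷ ys)
        ≡ agreeAndʷ a (x ∷ xs) b (y ∷ ys) xs ys (sameOrder (x ∷ xs) (y ∷ ys))
    agreeAndʷ-solution a x xs b y ys e₁ e₂ e₃ e₄ rewrite e₁ | e₂ | e₃ | e₄
      with x ∷ xs | y ∷ ys | sameOrder (x ∷ xs) (y ∷ ys)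
    ... | _ | _ | _ = refl

agreeᵇ : ℕ → ℕ → ℕ × ℕ → Bool
agreeᵇ s x (t , y) = does ((s <ᵇ t) Bool.≟ (x <ᵇ y)) ∧ does ((t <ᵇ s) Bool.≟ (y <ᵇ x))

private
  agreeAndʷ≡ : ∀ a p b q xs ys z → agreeAndʷ a p b q xs ys z ≡ all (agreeᵇ a b) (zip xs ys) ∧ z
  agreeAndʷ≡ a p b q []       _        z = refl
  agreeAndʷ≡ a p b q (_ ∷ _)  []       z = refl
  agreeAndʷ≡ a p b q (x ∷ xs) (y ∷ ys) z with a <ᵇ x | b <ᵇ y | x <ᵇ a | y <ᵇ b
  ... | true  | false | _     | _     = refl
  ... | false | true  | _     | _     = refl
  ... | true  | true  | true  | false = refl
  ... | true  | true  | false | true  = refl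
  ... | false | false | true  | false = refl
  ... | false | false | false | true  = refl
  ... | true  | true  | true  | true  = agreeAndʷ≡ a p b q xs ys z
  ... | true  | true  | false | false = agreeAndʷ≡ a p b q xs ys z
  ... | false | false | true  | true  = agreeAndʷ≡ a p b q xs ys z
  ... | false | false | false | false = agreeAndʷ≡ a p b q xs ys z

subseqs-∷ : ∀ k x xs → subseqs (suc k) (x ∷ xs) ≡ map (x ∷_) (subseqs k xs) ++ subseqs (suc k) xs
subseqs-∷ k x xs = trans (subseqs-∷ʷ k x xs) (appendʷ≡++ k x xs (map (x ∷_) (subseqs k xs)) (subseqs (suc k) xs))

sameOrder-∷ : ∀ s σ x c → sameOrder (s ∷ σ) (x ∷ c) ≡ all (agreeᵇ s x) (zip σ c) ∧ sameOrder σ c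
sameOrder-∷ s σ x c = agreeAndʷ≡ s σ x c σ c (sameOrder σ c)

-- Occurrences of patterns as order-isomorphic subsequences

record SameSide (s x t y : ℕ) : Set where
  constructor _,_
  field
    lt : (s <ᵇ t) ≡ (x <ᵇ y)
    gt : (t <ᵇ s) ≡ (y <ᵇ x)

infix 4 _∼_ _≼_

data _∼_ : List ℕ → List ℕ → Set where
  []  : [] ∼ []
  _∷_ : Pointwise (SameSide s x) σ c → σ ∼ c → s ∷ σ ∼ x ∷ c

_≼_ : List ℕ → List ℕ → Set
σ ≼ π = ∃[ c ] c ⊆ π × σ ∼ c

∼-length : σ ∼ c → length σ ≡ length c
∼-length []      = refl
∼-length (_ ∷ o) = cong suc (∼-length o)

T-agreeᵇ : ∀ s x t y → T (agreeᵇ s x (t , y)) ⇔ SameSide s x t y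
T-agreeᵇ s x t y with (s <ᵇ t) Bool.≟ (x <ᵇ y) | (t <ᵇ s) Bool.≟ (y <ᵇ x)
... | yes p | yes q = mk⇔ (λ _ → p , q) (λ _ → tt)
... | yes _ | no ¬q = mk⇔ (λ ()) (λ (_ , q) → ¬q q)
... | no ¬p | _     = mk⇔ (λ ()) (λ (p , _) → ¬p p)

T-all-agreeᵇ : length σ ≡ length c → T (all (agreeᵇ s x) (zip σ c)) ⇔ Pointwise (SameSide s x) σ c
T-all-agreeᵇ {[]}    {[]}    _ = mk⇔ (λ _ → []) (λ _ → tt)
T-all-agreeᵇ {t ∷ σ} {y ∷ c} {s} {x} e = mk⇔
  (λ h → let p , q = Equivalence.to (T-∧ {agreeᵇ s x (t , y)}) h in
         Equivalence.to (T-agreeᵇ s x t y) p ∷ Equivalence.to (T-all-agreeᵇ (suc-injective e)) q)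
  (λ { (p ∷ q) → Equivalence.from T-∧ (Equivalence.from (T-agreeᵇ s x t y) p ,
                                        Equivalence.from (T-all-agreeᵇ (suc-injective e)) q) })

sameOrder⁻ : T (sameOrder σ c) → σ ∼ c
sameOrder⁻ {[]}    {[]}    _ = []
sameOrder⁻ {s ∷ σ} {x ∷ c} h
  with p , q ← Equivalence.to (T-∧ {all (agreeᵇ s x) (zip σ c)}) (subst T (sameOrder-∷ s σ x c) h)
  with o ← sameOrder⁻ q
  = Equivalence.to (T-all-agreeᵇ (∼-length o)) p ∷ o

sameOrder⁺ : σ ∼ c → T (sameOrder σ c)
sameOrder⁺ []                      = tt
sameOrder⁺ {s ∷ σ} {x ∷ c} (p ∷ o) = subst T (sym (sameOrder-∷ s σ x c))
  (Equivalence.from T-∧ (Equivalence.from (T-all-agreeᵇ (∼-length o)) p , sameOrder⁺ o))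

Any-subseqs⁻ : ∀ {P : List ℕ → Set} k π → Any P (subseqs k π) → ∃[ c ] c ⊆ π × P c
Any-subseqs⁻ zero    π        (here p) = [] , minimum π , p
Any-subseqs⁻ {P} (suc k) (x ∷ xs) a with Any.++⁻ (map (x ∷_) (subseqs k xs)) (subst (Any P) (subseqs-∷ k x xs) a)
... | inj₁ a′ = let c , c⊆xs , p = Any-subseqs⁻ k xs (Any.map⁻ a′) in x ∷ c , refl ∷ c⊆xs , p
... | inj₂ a′ = let c , c⊆xs , p = Any-subseqs⁻ (suc k) xs a′ in c , x ∷ʳ c⊆xs , p

Any-subseqs⁺ : ∀ {P : List ℕ → Set} → c ⊆ π → P c → Any P (subseqs (length c) π)
Any-subseqs⁺ []                            p = here p
Any-subseqs⁺ {c = []} (_ ∷ʳ _)             p = here p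
Any-subseqs⁺ {c = _ ∷ c} {π = _ ∷ π} {P} (x ∷ʳ c⊆π) p =
  subst (Any P) (sym (subseqs-∷ (length c) x π))
    (Any.++⁺ʳ (map (x ∷_) (subseqs (length c) π)) (Any-subseqs⁺ c⊆π p))
Any-subseqs⁺ {c = x ∷ c} {π = x ∷ π} {P} (refl ∷ c⊆π) p =
  subst (Any P) (sym (subseqs-∷ (length c) x π)) (Any.++⁺ˡ (Any.map⁺ (Any-subseqs⁺ c⊆π p)))

contains⁻ : T (contains σ π) → σ ≼ π
contains⁻ {σ} {π} h =
  let c , c⊆π , o = Any-subseqs⁻ (length σ) π (Any.any⁻ (sameOrder σ) _ h) in c , c⊆π , sameOrder⁻ o

contains⁺ : σ ≼ π → T (contains σ π)
contains⁺ {σ} {π} (c , c⊆π , o) = Any.any⁺ (sameOrder σ)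
  (subst (λ k → Any (T ∘ sameOrder σ) (subseqs k π)) (sym (∼-length o)) (Any-subseqs⁺ c⊆π (sameOrder⁺ o)))

T⇔→≡ : ∀ {p q : Bool} → T p ⇔ T q → p ≡ q
T⇔→≡ {false} {false} _ = refl
T⇔→≡ {false} {true}  e = contradiction tt (Equivalence.from e)
T⇔→≡ {true}  {false} e = contradiction tt (Equivalence.to e)
T⇔→≡ {true}  {true}  _ = refl

contains-≡ : ∀ {σ′ π′} → σ ≼ π ⇔ σ′ ≼ π′ → contains σ π ≡ contains σ′ π′
contains-≡ e =
  T⇔→≡ (mk⇔ (contains⁺ ∘ Equivalence.to e ∘ contains⁻) (contains⁺ ∘ Equivalence.from e ∘ contains⁻))

contains≡true : σ ≼ π → contains σ π ≡ true
contains≡true = Equivalence.to T-≡ ∘ contains⁺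

<ᵇ-true : a < b → (a <ᵇ b) ≡ true
<ᵇ-true a<b = Equivalence.to T-≡ (<⇒<ᵇ a<b)

<ᵇ-false : b ≤ a → (a <ᵇ b) ≡ false
<ᵇ-false {b = b} {a = a} b≤a with a <ᵇ b in eq
... | false = refl
... | true  = contradiction (<ᵇ⇒< a b (subst T (sym eq) tt)) (≤⇒≯ b≤a)

sameSide-sym : SameSide s x t y → SameSide x s y t
sameSide-sym (p , q) = sym p , sym q

sameSide-< : SameSide s x t y → s < t → x < y
sameSide-< {x = x} {y = y} (p , _) s<t = <ᵇ⇒< x y (subst T p (<⇒<ᵇ s<t))

sameSide-> : SameSide s x t y → t < s → y < x
sameSide-> (p , q) = sameSide-< (q , p)

sameSide-<⁺ : s < t → x < y → SameSide s x t y
sameSide-<⁺ s<t x<y =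
  trans (<ᵇ-true s<t) (sym (<ᵇ-true x<y)) , trans (<ᵇ-false (<⇒≤ s<t)) (sym (<ᵇ-false (<⇒≤ x<y)))

sameSide->⁺ : t < s → y < x → SameSide s x t y
sameSide->⁺ t<s y<x = let p , q = sameSide-<⁺ t<s y<x in q , p

-- Occurrences after inserting a new maximum

Pointwise-below : Pointwise (SameSide s x) σ c → All (_< x) c → All (_< s) σ
Pointwise-below []        []          = []
Pointwise-below (p ∷ row) (y<x ∷ c<x) = sameSide-> (sameSide-sym p) y<x ∷ Pointwise-below row c<x

Pointwise-from-All : ∀ {R : ℕ → ℕ → Set} {P Q : ℕ → Set} {us vs} → (∀ {u v} → P u → Q v → R u v) →
                     length us ≡ length vs → All P us → All Q vs → Pointwise R us vs
Pointwise-from-All f _ []       []       = []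
Pointwise-from-All f e (p ∷ ps) (q ∷ qs) = f p q ∷ Pointwise-from-All f (suc-injective e) ps qs

length-∷ʳ : ∀ (c : List ℕ) x → length (c ++ [ x ]) ≡ suc (length c)
length-∷ʳ c x = trans (length-++ c) (+-comm (length c) 1)

Pointwise-∷ʳ⁻ : ∀ {R : ℕ → ℕ → Set} us vs {u v} →
                Pointwise R (us ++ [ u ]) (vs ++ [ v ]) → Pointwise R us vs × R u v
Pointwise-∷ʳ⁻ []       []       (r ∷ [])  = [] , r
Pointwise-∷ʳ⁻ (_ ∷ us) (_ ∷ vs) (r ∷ rs) = let rs′ , r′ = Pointwise-∷ʳ⁻ us vs rs in r ∷ rs′ , r′
Pointwise-∷ʳ⁻ []       (_ ∷ vs) {v = v} (_ ∷ rs) =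
  contradiction (trans (Pointwise-length rs) (length-∷ʳ vs v)) λ ()
Pointwise-∷ʳ⁻ (_ ∷ us) []       {u = u} (_ ∷ rs) =
  contradiction (trans (sym (length-∷ʳ us u)) (Pointwise-length rs)) λ ()

∼-∷-max⁻ : All (_< x) c → s ∷ σ ∼ x ∷ c → All (_< s) σ
∼-∷-max⁻ c<x (row ∷ _) = Pointwise-below row c<x

∼-∷-max⁺ : All (_< s) σ → All (_< x) c → σ ∼ c → s ∷ σ ∼ x ∷ c
∼-∷-max⁺ σ<s c<x o = Pointwise-from-All sameSide->⁺ (∼-length o) σ<s c<x ∷ o

∼-∷-max-swap : ∀ {x′} → All (_< x) c → All (_< x′) c → s ∷ σ ∼ x ∷ c → s ∷ σ ∼ x′ ∷ c
∼-∷-max-swap c<x c<x′ o@(_ ∷ o′) = ∼-∷-max⁺ (∼-∷-max⁻ c<x o) c<x′ o′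

∼-insert₂⁻ : h < m → All (_< h) c → a ∷ b ∷ σ ∼ h ∷ m ∷ c → a < b × All (_< a) σ
∼-insert₂⁻ h<m c<h ((p ∷ row) ∷ _) = sameSide-< (sameSide-sym p) h<m , Pointwise-below row c<h

∼-∷ʳ-length : ∀ σ c → σ ++ [ t ] ∼ c ++ [ m ] → length σ ≡ length c
∼-∷ʳ-length {t} {m} σ c o = suc-injective (trans (sym (length-∷ʳ σ t)) (trans (∼-length o) (length-∷ʳ c m)))

∼-∷ʳ⁻ : ∀ σ c → σ ++ [ t ] ∼ c ++ [ m ] → σ ∼ c
∼-∷ʳ⁻ []      []      _         = []
∼-∷ʳ⁻ (_ ∷ σ) (_ ∷ c) (row ∷ o) = proj₁ (Pointwise-∷ʳ⁻ σ c row) ∷ ∼-∷ʳ⁻ σ c o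
∼-∷ʳ⁻ []      (_ ∷ c) o         = contradiction (∼-∷ʳ-length [] (_ ∷ c) o) λ ()
∼-∷ʳ⁻ (_ ∷ σ) []      o         = contradiction (∼-∷ʳ-length (_ ∷ σ) [] o) λ ()

∼-∷ʳ-max⁻ : ∀ σ c → All (_< m) c → σ ++ [ t ] ∼ c ++ [ m ] → All (_< t) σ
∼-∷ʳ-max⁻ []      _       _           _         = []
∼-∷ʳ-max⁻ (_ ∷ σ) (_ ∷ c) (x<m ∷ c<m) (row ∷ o) =
  sameSide-< (sameSide-sym (proj₂ (Pointwise-∷ʳ⁻ σ c row))) x<m ∷ ∼-∷ʳ-max⁻ σ c c<m o
∼-∷ʳ-max⁻ (_ ∷ σ) []      _           o         = contradiction (∼-∷ʳ-length (_ ∷ σ) [] o) λ ()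

∼-∷ʳ-max⁺ : All (_< t) σ → All (_< m) c → σ ∼ c → σ ++ [ t ] ∼ c ++ [ m ]
∼-∷ʳ-max⁺ []          []          []        = [] ∷ []
∼-∷ʳ-max⁺ (s<t ∷ σ<t) (x<m ∷ c<m) (row ∷ o) =
  Pointwise.++⁺ row (sameSide-<⁺ s<t x<m ∷ []) ∷ ∼-∷ʳ-max⁺ σ<t c<m o

⊆-∷ʳ⁻ : ∀ π → c ⊆ π ++ [ m ] → c ⊆ π ⊎ ∃[ c′ ] c ≡ c′ ++ [ m ] × c′ ⊆ π
⊆-∷ʳ⁻ []      (_ ∷ʳ [])   = inj₁ []
⊆-∷ʳ⁻ []      (refl ∷ []) = inj₂ ([] , refl , [])
⊆-∷ʳ⁻ (x ∷ π) (.x ∷ʳ c⊆)  with ⊆-∷ʳ⁻ π c⊆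
... | inj₁ c⊆π             = inj₁ (x ∷ʳ c⊆π)
... | inj₂ (c′ , e , c′⊆π) = inj₂ (c′ , e , x ∷ʳ c′⊆π)
⊆-∷ʳ⁻ (x ∷ π) (refl ∷ c⊆) with ⊆-∷ʳ⁻ π c⊆
... | inj₁ c⊆π                = inj₁ (refl ∷ c⊆π)
... | inj₂ (c′ , refl , c′⊆π) = inj₂ (x ∷ c′ , refl , refl ∷ c′⊆π)

¬Any-above : All (_< s) σ → ¬ Any (s <_) σ
¬Any-above σ<s = All¬⇒¬Any (All.map <⇒≯ σ<s)

≼-⊆ : ∀ {π′} → π ⊆ π′ → σ ≼ π → σ ≼ π′
≼-⊆ π⊆π′ (c , c⊆π , o) = c , ⊆-trans c⊆π π⊆π′ , o

≼-tail : s ∷ σ ≼ π → σ ≼ π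
≼-tail (_ ∷ c , c⊆π , _ ∷ o) = c , ∷ˡ⁻ c⊆π , o

≼-init : ∀ σ → σ ++ [ t ] ≼ π → σ ≼ π
≼-init σ (c , c⊆π , o) with initLast c
... | []       = contradiction (trans (sym (∼-length o)) (length-∷ʳ σ _)) λ ()
... | c′ ∷ʳ′ y = c′ , ⊆-trans (++⁺ʳ [ y ] ⊆-refl) c⊆π , ∼-∷ʳ⁻ σ c′ o

≼-∷-max : Any (s <_) σ → All (_< m) π → s ∷ σ ≼ m ∷ π ⇔ s ∷ σ ≼ π
≼-∷-max {m = m} s<σ π<m = mk⇔ to (≼-⊆ (m ∷ʳ ⊆-refl))
  where
  to : _ ≼ m ∷ _ → _ ≼ _
  to (c , _ ∷ʳ c⊆π , o)       = c , c⊆π , o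
  to (_ ∷ c , refl ∷ c⊆π , o) = contradiction s<σ (¬Any-above (∼-∷-max⁻ (All-resp-⊆ c⊆π π<m) o))

≼-∷-max-head : All (_< s) σ → All (_< m) π → s ∷ σ ≼ m ∷ π ⇔ σ ≼ π
≼-∷-max-head {m = m} σ<s π<m = mk⇔ to from
  where
  to : _ ≼ m ∷ _ → _ ≼ _
  to (c , _ ∷ʳ c⊆π , o)           = ≼-tail (c , c⊆π , o)
  to (_ ∷ c , refl ∷ c⊆π , _ ∷ o) = c , c⊆π , o
  from : _ ≼ _ → _ ≼ m ∷ _
  from (c , c⊆π , o) = m ∷ c , refl ∷ c⊆π , ∼-∷-max⁺ σ<s (All-resp-⊆ c⊆π π<m) o

≼-∷ʳ-max : ∀ σ → Any (t <_) σ → All (_< m) π → σ ++ [ t ] ≼ π ++ [ m ] ⇔ σ ++ [ t ] ≼ π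
≼-∷ʳ-max {m = m} {π = π} σ t<σ π<m = mk⇔ to (≼-⊆ (++⁺ʳ [ m ] ⊆-refl))
  where
  to : _ ≼ π ++ [ m ] → _ ≼ π
  to (c , c⊆ , o) with ⊆-∷ʳ⁻ π c⊆
  ... | inj₁ c⊆π                = c , c⊆π , o
  ... | inj₂ (c′ , refl , c′⊆π) =
    contradiction t<σ (¬Any-above (∼-∷ʳ-max⁻ σ c′ (All-resp-⊆ c′⊆π π<m) o))

≼-∷ʳ-max-last : ∀ σ → All (_< t) σ → All (_< m) π → σ ++ [ t ] ≼ π ++ [ m ] ⇔ σ ≼ π
≼-∷ʳ-max-last {m = m} {π = π} σ σ<t π<m = mk⇔ to from
  where
  to : _ ≼ π ++ [ m ] → σ ≼ π
  to (c , c⊆ , o) with ⊆-∷ʳ⁻ π c⊆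
  ... | inj₁ c⊆π                = ≼-init σ (c , c⊆π , o)
  ... | inj₂ (c′ , refl , c′⊆π) = c′ , c′⊆π , ∼-∷ʳ⁻ σ c′ o
  from : σ ≼ π → _ ≼ π ++ [ m ]
  from (c , c⊆π , o) = c ++ [ m ] , ++⁺ c⊆π ⊆-refl , ∼-∷ʳ-max⁺ σ<t (All-resp-⊆ c⊆π π<m) o

-- In h ∷ m ∷ π with π < h < m, an occurrence using m but not h can use h instead, and one using
-- both is excluded by the hypothesis on the pattern a ∷ b ∷ σ.
≼-insert₂ : b < a ⊎ Any (a <_) σ → h < m → All (_< h) π →
            a ∷ b ∷ σ ≼ h ∷ m ∷ π ⇔ a ∷ b ∷ σ ≼ h ∷ π
≼-insert₂ {h = h} {m = m} {π = π} ab h<m π<h = mk⇔ to (≼-⊆ (refl ∷ m ∷ʳ ⊆-refl))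
  where
  to : _ ≼ h ∷ m ∷ π → _ ≼ h ∷ π
  to (c , _ ∷ʳ _ ∷ʳ c⊆π , o)              = c , h ∷ʳ c⊆π , o
  to (_ ∷ c , refl ∷ _ ∷ʳ c⊆π , o)        = h ∷ c , refl ∷ c⊆π , o
  to (_ ∷ c , _ ∷ʳ refl ∷ c⊆π , o)        =
    let c<h = All-resp-⊆ c⊆π π<h
    in  h ∷ c , refl ∷ c⊆π , ∼-∷-max-swap (All.map (λ y<h → <-trans y<h h<m) c<h) c<h o
  to (_ ∷ _ ∷ c , refl ∷ refl ∷ c⊆π , o) =
    let a<b , σ<a = ∼-insert₂⁻ h<m (All-resp-⊆ c⊆π π<h) o
    in  contradiction ab [ <-asym a<b , ¬Any-above σ<a ]′

ascending : ℕ → List ℕ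
ascending k = map suc (upTo k)

ascending-∷ʳ : ascending (suc k) ≡ ascending k ++ [ suc k ]
ascending-∷ʳ {k} = trans (cong (map suc) (sym (upTo-∷ʳ k))) (map-++ suc (upTo k) [ k ])

ascending-below : All (_< suc k) (ascending k)
ascending-below {k} = map⁺ (applyUpTo⁺₁ _ k s<s)

ascending-∷-max : All (_< m) π → contains (ascending (2 + k)) (m ∷ π) ≡ contains (ascending (2 + k)) π
ascending-∷-max π<m = contains-≡ (≼-∷-max (here (s<s z<s)) π<m)

ascending-∷ʳ-max : All (_< m) π → contains (ascending (suc k)) (π ++ [ m ]) ≡ contains (ascending k) π
ascending-∷ʳ-max {m} {π} {k} π<m =
  subst (λ σ → contains σ (π ++ [ m ]) ≡ contains (ascending k) π) (sym ascending-∷ʳ)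
    (contains-≡ (≼-∷ʳ-max-last (ascending k) ascending-below π<m))

ascending-insert₂ : h < m → All (_< h) π →
                    contains (ascending (3 + k)) (h ∷ m ∷ π) ≡ contains (ascending (3 + k)) (h ∷ π)
ascending-insert₂ h<m π<h = contains-≡ (≼-insert₂ (inj₂ (here (s<s z<s))) h<m π<h)

contains-ascending-1 : contains (ascending 1) (x ∷ π) ≡ true
contains-ascending-1 {x} {π} = contains≡true {σ = ascending 1} (x ∷ [] , refl ∷ minimum π , [] ∷ [])

contains-ascending-2 : h < m → contains (ascending 2) (h ∷ m ∷ π) ≡ true
contains-ascending-2 {h} {m} {π} h<m =
  contains≡true {σ = ascending 2}
    (h ∷ m ∷ [] , refl ∷ refl ∷ minimum π , (sameSide-<⁺ (s<s z<s) h<m ∷ []) ∷ [] ∷ [])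

dPattern-∷ʳ : dPattern (2 + k) ≡ (2 + k ∷ ascending k) ++ [ suc k ]
dPattern-∷ʳ {k} = cong (2 + k ∷_) ascending-∷ʳ

dPattern-∷-max : All (_< m) π → contains (dPattern (suc k)) (m ∷ π) ≡ contains (ascending k) π
dPattern-∷-max {k = k} π<m = contains-≡ (≼-∷-max-head (ascending-below {k}) π<m)

dPattern-∷ʳ-max : All (_< m) π → contains (dPattern (2 + k)) (π ++ [ m ]) ≡ contains (dPattern (2 + k)) π
dPattern-∷ʳ-max {m} {π} {k} π<m =
  subst (λ σ → contains σ (π ++ [ m ]) ≡ contains σ π) (sym dPattern-∷ʳ)
    (contains-≡ (≼-∷ʳ-max (2 + k ∷ ascending k) (here (n<1+n _)) π<m))

dPattern-insert₂ : h < m → All (_< h) π →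
                   contains (dPattern (2 + k)) (h ∷ m ∷ π) ≡ contains (dPattern (2 + k)) (h ∷ π)
dPattern-insert₂ h<m π<h = contains-≡ (≼-insert₂ (inj₁ (s<s z<s)) h<m π<h)

132-∼ : ∀ {p q r} → p < r → r < q → 1 ∷ 3 ∷ 2 ∷ [] ∼ p ∷ q ∷ r ∷ []
132-∼ p<r r<q =
    (sameSide-<⁺ (s<s z<s) (<-trans p<r r<q) ∷ sameSide-<⁺ (s<s z<s) p<r ∷ [])
  ∷ (sameSide->⁺ (s<s (s<s z<s)) r<q ∷ [])
  ∷ [] ∷ []

2341-∼ : ∀ {p q r z} → z < p → p < q → q < r → 2 ∷ 3 ∷ 4 ∷ 1 ∷ [] ∼ p ∷ q ∷ r ∷ z ∷ []
2341-∼ z<p p<q q<r =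
    ( sameSide-<⁺ (s<s (s<s z<s)) p<q
    ∷ sameSide-<⁺ (s<s (s<s z<s)) (<-trans p<q q<r)
    ∷ sameSide->⁺ (s<s z<s) z<p ∷ [])
  ∷ (sameSide-<⁺ (s<s (s<s (s<s z<s))) q<r ∷ sameSide->⁺ (s<s z<s) (<-trans z<p p<q) ∷ [])
  ∷ (sameSide->⁺ (s<s z<s) (<-trans z<p (<-trans p<q q<r)) ∷ [])
  ∷ [] ∷ []

3241-∼ : ∀ {p q r z} → z < q → q < p → p < r → 3 ∷ 2 ∷ 4 ∷ 1 ∷ [] ∼ p ∷ q ∷ r ∷ z ∷ []
3241-∼ z<q q<p p<r =
    ( sameSide->⁺ (s<s (s<s z<s)) q<p
    ∷ sameSide-<⁺ (s<s (s<s (s<s z<s))) p<r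
    ∷ sameSide->⁺ (s<s z<s) (<-trans z<q q<p) ∷ [])
  ∷ (sameSide-<⁺ (s<s (s<s z<s)) (<-trans q<p p<r) ∷ sameSide->⁺ (s<s z<s) z<q ∷ [])
  ∷ (sameSide->⁺ (s<s z<s) (<-trans z<q (<-trans q<p p<r)) ∷ [])
  ∷ [] ∷ []

inP132-cong : ∀ {π′} → contains (1 ∷ 3 ∷ 2 ∷ []) π ≡ contains (1 ∷ 3 ∷ 2 ∷ []) π′ →
              contains (2 ∷ 3 ∷ 4 ∷ 1 ∷ []) π ≡ contains (2 ∷ 3 ∷ 4 ∷ 1 ∷ []) π′ →
              contains (3 ∷ 2 ∷ 4 ∷ 1 ∷ []) π ≡ contains (3 ∷ 2 ∷ 4 ∷ 1 ∷ []) π′ →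
              inP132 π ≡ inP132 π′
inP132-cong e₁ e₂ e₃ = cong₂ _∧_ (cong not e₁) (cong₂ _∧_ (cong not e₂) (cong not e₃))

inP132-∷-max : All (_< m) π → inP132 (m ∷ π) ≡ inP132 π
inP132-∷-max {m} {π} π<m = inP132-cong {m ∷ π} {π}
  (contains-≡ (≼-∷-max (here (s<s z<s)) π<m))
  (contains-≡ (≼-∷-max (here (s<s (s<s z<s))) π<m))
  (contains-≡ (≼-∷-max (there (here (s<s (s<s (s<s z<s))))) π<m))

inP132-∷ʳ-max : All (_< m) π → inP132 (π ++ [ m ]) ≡ inP132 π
inP132-∷ʳ-max {m} {π} π<m = inP132-cong {π ++ [ m ]} {π}
  (contains-≡ (≼-∷ʳ-max (1 ∷ 3 ∷ []) (there (here (s<s (s<s z<s)))) π<m))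
  (contains-≡ (≼-∷ʳ-max (2 ∷ 3 ∷ 4 ∷ []) (here (s<s z<s)) π<m))
  (contains-≡ (≼-∷ʳ-max (3 ∷ 2 ∷ 4 ∷ []) (here (s<s z<s)) π<m))

inP132-insert₂ : h < m → All (_< h) π → inP132 (h ∷ m ∷ π) ≡ inP132 (h ∷ π)
inP132-insert₂ {h} {m} {π} h<m π<h = inP132-cong {h ∷ m ∷ π} {h ∷ π}
  (contains-≡ (≼-insert₂ (inj₂ (here (s<s z<s))) h<m π<h))
  (contains-≡ (≼-insert₂ (inj₂ (here (s<s (s<s z<s)))) h<m π<h))
  (contains-≡ (≼-insert₂ (inj₁ (s<s (s<s z<s))) h<m π<h))

inP132≡false-132 : 1 ∷ 3 ∷ 2 ∷ [] ≼ π → inP132 π ≡ false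
inP132≡false-132 o rewrite contains≡true o = refl

inP132≡false-2341 : 2 ∷ 3 ∷ 4 ∷ 1 ∷ [] ≼ π → inP132 π ≡ false
inP132≡false-2341 {π} o rewrite contains≡true o = ∧-zeroʳ (avoids (1 ∷ 3 ∷ 2 ∷ []) π)

inP132≡false-3241 : 3 ∷ 2 ∷ 4 ∷ 1 ∷ [] ≼ π → inP132 π ≡ false
inP132≡false-3241 {π} o rewrite contains≡true o | ∧-zeroʳ (avoids (2 ∷ 3 ∷ 4 ∷ 1 ∷ []) π) =
  ∧-zeroʳ (avoids (1 ∷ 3 ∷ 2 ∷ []) π)

inP132≡false-insert₂ : ∀ {z} → h < z → z < m → [ z ] ⊆ π → inP132 (h ∷ m ∷ π) ≡ false
inP132≡false-insert₂ h<z z<m z∈π = inP132≡false-132 (_ , refl ∷ refl ∷ z∈π , 132-∼ h<z z<m)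

late-⊆ : ∀ {p q y} mid ys → p ∷ q ∷ m ∷ y ∷ [] ⊆ p ∷ q ∷ mid ++ m ∷ y ∷ ys
late-⊆ mid ys = refl ∷ refl ∷ ++⁺ˡ mid (refl ∷ refl ∷ minimum ys)

inP132≡false-late : ∀ {p q y} mid ys → p ≢ q → p ≢ y → q ≢ y → p < m → q < m → y < m →
                    inP132 (p ∷ q ∷ mid ++ m ∷ y ∷ ys) ≡ false
inP132≡false-late {m} {p} {q} {y} mid ys p≢q p≢y q≢y p<m q<m y<m with <-cmp p y | <-cmp q y
... | tri< p<y _ _ | _ = inP132≡false-132 (_ , ⊆-trans (refl ∷ q ∷ʳ ⊆-refl) (late-⊆ mid ys) , 132-∼ p<y y<m)
... | _ | tri< q<y _ _ = inP132≡false-132 (_ , ⊆-trans (p ∷ʳ ⊆-refl) (late-⊆ mid ys) , 132-∼ q<y y<m)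
... | tri≈ _ p≡y _ | _ = contradiction p≡y p≢y
... | _ | tri≈ _ q≡y _ = contradiction q≡y q≢y
... | tri> _ _ y<p | tri> _ _ y<q with <-cmp p q
...   | tri< p<q _ _ = inP132≡false-2341 (_ , late-⊆ mid ys , 2341-∼ y<p p<q q<m)
...   | tri≈ _ p≡q _ = contradiction p≡q p≢q
...   | tri> _ _ q<p = inP132≡false-3241 (_ , late-⊆ mid ys , 3241-∼ y<q q<p p<m)

-- Lists of length one are excluded: inserting after their only entry is inserting at the end.
maxFirst : List ℕ → Bool
maxFirst (h ∷ π@(_ ∷ _)) = all (_<ᵇ h) π
maxFirst _               = false

maxFirst-∷-max : All (_< m) (x ∷ π) → maxFirst (m ∷ x ∷ π) ≡ true
maxFirst-∷-max π<m = Equivalence.to T-≡ (all⁻ _ (All.map <⇒<ᵇ π<m))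

maxFirst-insert₂ : h < m → maxFirst (h ∷ m ∷ π) ≡ false
maxFirst-insert₂ h<m rewrite <ᵇ-false (<⇒≤ h<m) = refl

maxFirst-∷ʳ-max : ∀ π → h < m → maxFirst ((h ∷ π) ++ [ m ]) ≡ false
maxFirst-∷ʳ-max []      h<m rewrite <ᵇ-false (<⇒≤ h<m) = refl
maxFirst-∷ʳ-max {h} {m} (x ∷ π) h<m with maxFirst ((h ∷ x ∷ π) ++ [ m ]) in eq
... | false = refl
... | true  = contradiction (all⁺ _ (x ∷ π ++ [ m ]) (subst T (sym eq) tt)) λ below →
                <⇒≯ h<m (<ᵇ⇒< m h (All.head (++⁻ʳ (x ∷ π) below)))

maxFirst⁻ : maxFirst (h ∷ x ∷ π) ≡ true → All (_< h) (x ∷ π)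
maxFirst⁻ {h} {x} {π} e = All.map (<ᵇ⇒< _ h) (all⁺ _ (x ∷ π) (subst T (sym e) tt))

not-all-below : ∀ h π → all (_<ᵇ h) π ≡ false → ∃[ z ] [ z ] ⊆ π × h ≤ z
not-all-below h (x ∷ π) e with x <ᵇ h in eq
... | false = x , refl ∷ minimum π , ≮⇒≥ (λ x<h → subst T eq (<⇒<ᵇ x<h))
... | true  = let z , z∈π , h≤z = not-all-below h π e in z , x ∷ʳ z∈π , h≤z

inP132-insert₂-maxFirst : ∀ r → h < m → All (_< m) (x ∷ π) → Unique (h ∷ x ∷ π) →
                          inP132 (h ∷ m ∷ x ∷ π) ∧ r ≡ inP132 (h ∷ x ∷ π) ∧ (maxFirst (h ∷ x ∷ π) ∧ r)
inP132-insert₂-maxFirst {h} {m} {x} {π} r h<m π<m (h∉π ∷ _) with maxFirst (h ∷ x ∷ π) in e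
... | true  = cong (_∧ r) (inP132-insert₂ h<m (maxFirst⁻ {h} {x} {π} e))
... | false =
  let z , z∈π , h≤z = not-all-below h (x ∷ π) e
      h<z = ≤∧≢⇒< h≤z (All.head (All-resp-⊆ z∈π h∉π))
  in trans (cong (_∧ r) (inP132≡false-insert₂ h<z (All.head (All-resp-⊆ z∈π π<m)) z∈π)) (sym (∧-zeroʳ _))

-- Counting 𝒫_n(132) by inserting the maximum

indicator : Bool → ℕ
indicator true  = 1
indicator false = 0

countᵇ : (List ℕ → Bool) → List (List ℕ) → ℕ
countᵇ Q L = length (filterᵇ Q L)

countᵇ-∷ : ∀ Q w L → countᵇ Q (w ∷ L) ≡ indicator (Q w) + countᵇ Q L
countᵇ-∷ Q w L with Q w
... | true  = refl
... | false = refl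

countᵇ-++ : ∀ Q L L′ → countᵇ Q (L ++ L′) ≡ countᵇ Q L + countᵇ Q L′
countᵇ-++ Q []      L′ = refl
countᵇ-++ Q (w ∷ L) L′ = begin
  countᵇ Q (w ∷ L ++ L′)                       ≡⟨ countᵇ-∷ Q w (L ++ L′) ⟩
  indicator (Q w) + countᵇ Q (L ++ L′)         ≡⟨ cong (_+_ (indicator (Q w))) (countᵇ-++ Q L L′) ⟩
  indicator (Q w) + (countᵇ Q L + countᵇ Q L′) ≡⟨ +-assoc (indicator (Q w)) _ _ ⟨
  indicator (Q w) + countᵇ Q L + countᵇ Q L′   ≡⟨ cong (_+ countᵇ Q L′) (countᵇ-∷ Q w L) ⟨
  countᵇ Q (w ∷ L) + countᵇ Q L′               ∎
  where open ≡-Reasoning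

countᵇ-cong : ∀ {Q Q′ L} → All (λ w → Q w ≡ Q′ w) L → countᵇ Q L ≡ countᵇ Q′ L
countᵇ-cong                  []       = refl
countᵇ-cong {Q} {Q′} {w ∷ L} (e ∷ es) = begin
  countᵇ Q (w ∷ L)                ≡⟨ countᵇ-∷ Q w L ⟩
  indicator (Q w) + countᵇ Q L    ≡⟨ cong₂ (λ b n → indicator b + n) e (countᵇ-cong es) ⟩
  indicator (Q′ w) + countᵇ Q′ L  ≡⟨ countᵇ-∷ Q′ w L ⟨
  countᵇ Q′ (w ∷ L)               ∎
  where open ≡-Reasoning

countᵇ-none : ∀ {Q L} → All (λ w → Q w ≡ false) L → countᵇ Q L ≡ 0
countᵇ-none             []       = refl
countᵇ-none {Q} {w ∷ L} (e ∷ es) =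
  trans (countᵇ-∷ Q w L) (cong₂ (λ b n → indicator b + n) e (countᵇ-none es))

𝒫[_] : (List ℕ → Bool) → List ℕ → Bool
𝒫[ R ] π = inP132 π ∧ R π

map-++-∷ : ∀ pre y (L : List (List ℕ)) → map (pre ++_) (map (y ∷_) L) ≡ map ((pre ++ [ y ]) ++_) L
map-++-∷ pre y L = trans (sym (map-∘ L)) (map-cong (λ w → sym (++-assoc pre [ y ] w)) L)

countᵇ-late : ∀ R {p q} mid π → p ≢ q → p < m → q < m → All (_< m) π → All (p ≢_) π → All (q ≢_) π →
              countᵇ 𝒫[ R ] (map ((p ∷ q ∷ mid) ++_) (insertions m π))
                ≡ indicator (𝒫[ R ] (p ∷ q ∷ mid ++ π ++ [ m ]))
countᵇ-late R mid [] _ _ _ _ _ _ = trans (countᵇ-∷ 𝒫[ R ] _ []) (+-identityʳ _)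
countᵇ-late {m} R {p} {q} mid (y ∷ ys) p≢q p<m q<m (y<m ∷ ys<m) (p≢y ∷ p≢ys) (q≢y ∷ q≢ys) = begin
  countᵇ 𝒫[ R ] (map (pre ++_) ((m ∷ y ∷ ys) ∷ map (y ∷_) (insertions m ys)))
    ≡⟨ countᵇ-∷ 𝒫[ R ] (pre ++ m ∷ y ∷ ys) _ ⟩
  indicator (inP132 (pre ++ m ∷ y ∷ ys) ∧ R (pre ++ m ∷ y ∷ ys))
    + countᵇ 𝒫[ R ] (map (pre ++_) (map (y ∷_) (insertions m ys)))
    ≡⟨ cong₂ (λ b L → indicator (b ∧ R (pre ++ m ∷ y ∷ ys)) + countᵇ 𝒫[ R ] L)
             (inP132≡false-late mid ys p≢q p≢y q≢y p<m q<m y<m) (map-++-∷ pre y (insertions m ys)) ⟩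
  countᵇ 𝒫[ R ] (map ((p ∷ q ∷ mid ++ [ y ]) ++_) (insertions m ys))
    ≡⟨ countᵇ-late R (mid ++ [ y ]) ys p≢q p<m q<m ys<m p≢ys q≢ys ⟩
  indicator (𝒫[ R ] (p ∷ q ∷ (mid ++ [ y ]) ++ ys ++ [ m ]))
    ≡⟨ cong (λ l → indicator (𝒫[ R ] (p ∷ q ∷ l))) (++-assoc mid [ y ] (ys ++ [ m ])) ⟩
  indicator (𝒫[ R ] (p ∷ q ∷ mid ++ y ∷ ys ++ [ m ])) ∎
  where
  open ≡-Reasoning
  pre = p ∷ q ∷ mid

countᵇ-insertions : ∀ R → All (_< m) (h ∷ π) → Unique (h ∷ π) →
  countᵇ 𝒫[ R ] (insertions m (h ∷ π))
    ≡ indicator (inP132 (h ∷ π) ∧ R (m ∷ h ∷ π))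
    + (indicator (inP132 (h ∷ π) ∧ (maxFirst (h ∷ π) ∧ R (h ∷ m ∷ π)))
    + indicator (inP132 (h ∷ π) ∧ R ((h ∷ π) ++ [ m ])))
countᵇ-insertions {m} {h} {[]} R _ _ =
  trans (countᵇ-∷ 𝒫[ R ] (m ∷ h ∷ []) _) (cong (_+_ (indicator (R (m ∷ h ∷ []))))
    (trans (countᵇ-∷ 𝒫[ R ] (h ∷ m ∷ []) []) (+-identityʳ _)))
countᵇ-insertions {m} {h} {x ∷ π} R hxπ<m@(h<m ∷ x<m ∷ π<m) u@((h≢x ∷ h≢π) ∷ x≢π ∷ _) = begin
  countᵇ 𝒫[ R ] ((m ∷ h ∷ x ∷ π) ∷ (h ∷ m ∷ x ∷ π) ∷ map (h ∷_) (map (x ∷_) (insertions m π)))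
    ≡⟨ trans (countᵇ-∷ 𝒫[ R ] (m ∷ h ∷ x ∷ π) _)
             (cong (_+_ (indicator (𝒫[ R ] (m ∷ h ∷ x ∷ π)))) (countᵇ-∷ 𝒫[ R ] (h ∷ m ∷ x ∷ π) _)) ⟩
  indicator (𝒫[ R ] (m ∷ h ∷ x ∷ π)) + (indicator (𝒫[ R ] (h ∷ m ∷ x ∷ π)) + countᵇ 𝒫[ R ] late)
    ≡⟨ cong₂ _+_ (cong (λ b → indicator (b ∧ R (m ∷ h ∷ x ∷ π))) (inP132-∷-max hxπ<m))
                 (cong₂ _+_ (cong indicator (inP132-insert₂-maxFirst (R (h ∷ m ∷ x ∷ π)) h<m (x<m ∷ π<m) u))
                            at-end) ⟩
  indicator (inP132 (h ∷ x ∷ π) ∧ R (m ∷ h ∷ x ∷ π))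
    + (indicator (inP132 (h ∷ x ∷ π) ∧ (maxFirst (h ∷ x ∷ π) ∧ R (h ∷ m ∷ x ∷ π)))
    + indicator (inP132 (h ∷ x ∷ π) ∧ R (h ∷ x ∷ π ++ [ m ]))) ∎
  where
  open ≡-Reasoning
  late = map (h ∷_) (map (x ∷_) (insertions m π))
  at-end : countᵇ 𝒫[ R ] late ≡ indicator (inP132 (h ∷ x ∷ π) ∧ R (h ∷ x ∷ π ++ [ m ]))
  at-end = begin
    countᵇ 𝒫[ R ] late
      ≡⟨ cong (countᵇ 𝒫[ R ]) (map-∘ (insertions m π)) ⟨
    countᵇ 𝒫[ R ] (map ((h ∷ x ∷ []) ++_) (insertions m π))
      ≡⟨ countᵇ-late R [] π h≢x h<m x<m π<m h≢π x≢π ⟩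
    indicator (inP132 (h ∷ x ∷ π ++ [ m ]) ∧ R (h ∷ x ∷ π ++ [ m ]))
      ≡⟨ cong (λ b → indicator (b ∧ R (h ∷ x ∷ π ++ [ m ]))) (inP132-∷ʳ-max hxπ<m) ⟩
    indicator (inP132 (h ∷ x ∷ π) ∧ R (h ∷ x ∷ π ++ [ m ]))      ∎

insertions-↭ : ∀ x π → All (_↭ x ∷ π) (insertions x π)
insertions-↭ x []      = ↭-refl ∷ []
insertions-↭ x (y ∷ π) =
  ↭-refl ∷ map⁺ (All.map (λ w↭ → ↭-trans (↭-prep y w↭) (↭-swap y x ↭-refl)) (insertions-↭ x π))

S-↭ : ∀ n → All (_↭ applyDownFrom suc n) (S n)
S-↭ zero    = ↭-refl ∷ []
S-↭ (suc n) = concat⁺ (map⁺ (All.map insert (S-↭ n)))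
  where
  insert : π ↭ applyDownFrom suc n → All (_↭ applyDownFrom suc (suc n)) (insertions (suc n) π)
  insert {π} π↭ = All.map (λ w↭ → ↭-trans w↭ (↭-prep (suc n) π↭)) (insertions-↭ (suc n) π)

↭-downFrom-length : π ↭ applyDownFrom suc k → length π ≡ k
↭-downFrom-length {k = k} π↭ = trans (↭-length π↭) (length-applyDownFrom suc k)

↭-downFrom-below : π ↭ applyDownFrom suc k → All (_< suc k) π
↭-downFrom-below {k = k} π↭ = All-resp-↭ (↭-sym π↭) (applyDownFrom⁺₁ suc k s<s)

↭-downFrom-unique : π ↭ applyDownFrom suc k → Unique π
↭-downFrom-unique {k = k} π↭ = Unique-resp-↭ (↭⇒↭ₛ (↭-sym π↭))
  (AllPairs.applyDownFrom⁺₁ suc k (λ j<i _ e → <-irrefl (sym (suc-injective e)) j<i))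

count𝒫 : (List ℕ → Bool) → ℕ → ℕ
count𝒫 R n = countᵇ 𝒫[ R ] (S n)

count𝒫-cong : ∀ {R R′} n → (∀ {π} → π ↭ applyDownFrom suc n → R π ≡ R′ π) →
              count𝒫 R n ≡ count𝒫 R′ n
count𝒫-cong n f = countᵇ-cong (All.map (λ {π} π↭ → cong (inP132 π ∧_) (f π↭)) (S-↭ n))

count𝒫-none : ∀ {R} n → (∀ {π} → π ↭ applyDownFrom suc n → R π ≡ false) → count𝒫 R n ≡ 0
count𝒫-none n f =
  countᵇ-none (All.map (λ {π} π↭ → trans (cong (inP132 π ∧_) (f π↭)) (∧-zeroʳ (inP132 π))) (S-↭ n))

-- The value at [] is never used: the permutations counted below are nonempty.
insert₂ : ℕ → List ℕ → List ℕ
insert₂ m []      = [ m ]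
insert₂ m (h ∷ π) = h ∷ m ∷ π

+-shuffle : ∀ a b c a′ b′ c′ → a + (b + c) + (a′ + (b′ + c′)) ≡ a + a′ + (b + b′ + (c + c′))
+-shuffle = solve 6 (λ a b c a′ b′ c′ → a :+ (b :+ c) :+ (a′ :+ (b′ :+ c′))
                                      := a :+ a′ :+ (b :+ b′ :+ (c :+ c′))) refl
  where open +-*-Solver

countᵇ-concatMap-insertions : ∀ R {L} → All (_↭ applyDownFrom suc (suc k)) L →
  countᵇ 𝒫[ R ] (concatMap (insertions (2 + k)) L)
    ≡ countᵇ 𝒫[ (λ π → R (2 + k ∷ π)) ] L
    + (countᵇ 𝒫[ (λ π → maxFirst π ∧ R (insert₂ (2 + k) π)) ] L
    + countᵇ 𝒫[ (λ π → R (π ++ [ 2 + k ])) ] L)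
countᵇ-concatMap-insertions R []                            = refl
countᵇ-concatMap-insertions R {[] ∷ _}      (π↭ ∷ _)        with () ← ↭-downFrom-length π↭
countᵇ-concatMap-insertions {k} R {(h ∷ π) ∷ L} (π↭ ∷ L↭) = begin
  countᵇ 𝒫[ R ] (insertions M (h ∷ π) ++ concatMap (insertions M) L)
    ≡⟨ countᵇ-++ 𝒫[ R ] (insertions M (h ∷ π)) _ ⟩
  countᵇ 𝒫[ R ] (insertions M (h ∷ π)) + countᵇ 𝒫[ R ] (concatMap (insertions M) L)
    ≡⟨ cong₂ _+_ (countᵇ-insertions R (↭-downFrom-below π↭) (↭-downFrom-unique π↭))
                 (countᵇ-concatMap-insertions R L↭) ⟩
  _ ≡⟨ +-shuffle (indicator (front (h ∷ π))) (indicator (middle (h ∷ π))) (indicator (end (h ∷ π)))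
                 (countᵇ front L) (countᵇ middle L) (countᵇ end L) ⟩
  _ ≡⟨ cong₂ _+_ (countᵇ-∷ front (h ∷ π) L)
                 (cong₂ _+_ (countᵇ-∷ middle (h ∷ π) L) (countᵇ-∷ end (h ∷ π) L)) ⟨
  _ ∎
  where
  open ≡-Reasoning
  M = 2 + k
  front middle end : List ℕ → Bool
  front  = 𝒫[ (λ π → R (M ∷ π)) ]
  middle = 𝒫[ (λ π → maxFirst π ∧ R (insert₂ M π)) ]
  end    = 𝒫[ (λ π → R (π ++ [ M ])) ]

count𝒫-insert : ∀ R n →
  count𝒫 R (2 + n) ≡ count𝒫 (λ π → R (2 + n ∷ π)) (1 + n)
                   + (count𝒫 (λ π → maxFirst π ∧ R (insert₂ (2 + n) π)) (1 + n)
                   + count𝒫 (λ π → R (π ++ [ 2 + n ])) (1 + n))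
count𝒫-insert R n = countᵇ-concatMap-insertions R (S-↭ (suc n))

count𝒫-maxFirst : ∀ (R : List ℕ → Bool) n →
                  count𝒫 (λ π → maxFirst π ∧ R π) (2 + n) ≡ count𝒫 (λ π → R (2 + n ∷ π)) (1 + n)
count𝒫-maxFirst R n = begin
  count𝒫 (λ π → maxFirst π ∧ R π) (2 + n)
    ≡⟨ count𝒫-insert (λ π → maxFirst π ∧ R π) n ⟩
  _ ≡⟨ cong₂ _+_ (count𝒫-cong (1 + n) front)
                 (cong₂ _+_ (count𝒫-none (1 + n) middle) (count𝒫-none (1 + n) end)) ⟩
  count𝒫 (λ π → R (2 + n ∷ π)) (1 + n) + 0
    ≡⟨ +-identityʳ _ ⟩
  count𝒫 (λ π → R (2 + n ∷ π)) (1 + n) ∎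
  where
  open ≡-Reasoning
  front : π ↭ applyDownFrom suc (1 + n) → maxFirst (2 + n ∷ π) ∧ R (2 + n ∷ π) ≡ R (2 + n ∷ π)
  front {[]}    π↭ with () ← ↭-downFrom-length π↭
  front {_ ∷ _} π↭ rewrite maxFirst-∷-max (↭-downFrom-below π↭) = refl
  middle : π ↭ applyDownFrom suc (1 + n) →
           maxFirst π ∧ (maxFirst (insert₂ (2 + n) π) ∧ R (insert₂ (2 + n) π)) ≡ false
  middle {[]}    _  = refl
  middle {h ∷ π} π↭ rewrite maxFirst-insert₂ {π = π} (All.head (↭-downFrom-below π↭)) = ∧-zeroʳ _
  end : π ↭ applyDownFrom suc (1 + n) → maxFirst (π ++ [ 2 + n ]) ∧ R (π ++ [ 2 + n ]) ≡ false
  end {[]}    _  = refl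
  end {h ∷ π} π↭ rewrite maxFirst-∷ʳ-max π (All.head (↭-downFrom-below π↭)) = refl

maxFirst-insert₂-cong : ∀ {R R′ : List ℕ → Bool} →
                        (∀ {h π} → h < m → All (_< h) π → R (h ∷ m ∷ π) ≡ R′ (h ∷ π)) →
                        All (_< m) π → maxFirst π ∧ R (insert₂ m π) ≡ maxFirst π ∧ R′ π
maxFirst-insert₂-cong                f []        = refl
maxFirst-insert₂-cong {π = _ ∷ []}     f _         = refl
maxFirst-insert₂-cong {π = h ∷ x ∷ π} f (h<m ∷ _) with maxFirst (h ∷ x ∷ π) in e
... | true  = f h<m (maxFirst⁻ {h} {x} {π} e)
... | false = refl

dPattern-recurrence : ∀ j n →
  count𝒫 (avoids (dPattern (2 + j))) (2 + n)
    ≡ count𝒫 (avoids (ascending (1 + j))) (1 + n)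
    + (count𝒫 (λ π → maxFirst π ∧ avoids (dPattern (2 + j)) π) (1 + n)
    + count𝒫 (avoids (dPattern (2 + j))) (1 + n))
dPattern-recurrence j n =
  trans (count𝒫-insert (avoids τ) n)
        (cong₂ _+_ (count𝒫-cong (1 + n) front)
                   (cong₂ _+_ (count𝒫-cong (1 + n) middle) (count𝒫-cong (1 + n) end)))
  where
  τ = dPattern (2 + j)
  front : π ↭ applyDownFrom suc (1 + n) → avoids τ (2 + n ∷ π) ≡ avoids (ascending (1 + j)) π
  front π↭ = cong not (dPattern-∷-max {k = 1 + j} (↭-downFrom-below π↭))
  middle : π ↭ applyDownFrom suc (1 + n) → maxFirst π ∧ avoids τ (insert₂ (2 + n) π) ≡ maxFirst π ∧ avoids τ π
  middle π↭ = maxFirst-insert₂-cong {R = avoids τ} {R′ = avoids τ}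
                (λ h<m π<h → cong not (dPattern-insert₂ {k = j} h<m π<h)) (↭-downFrom-below π↭)
  end : π ↭ applyDownFrom suc (1 + n) → avoids τ (π ++ [ 2 + n ]) ≡ avoids τ π
  end π↭ = cong not (dPattern-∷ʳ-max {k = j} (↭-downFrom-below π↭))

maxFirst-dPattern-recurrence : ∀ j n →
  count𝒫 (λ π → maxFirst π ∧ avoids (dPattern (2 + j)) π) (2 + n) ≡ count𝒫 (avoids (ascending (1 + j))) (1 + n)
maxFirst-dPattern-recurrence j n = trans (count𝒫-maxFirst (avoids (dPattern (2 + j))) n)
  (count𝒫-cong (1 + n) λ π↭ → cong not (dPattern-∷-max {k = 1 + j} (↭-downFrom-below π↭)))

ascending-recurrence : ∀ k n →
  count𝒫 (avoids (ascending (3 + k))) (2 + n)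
    ≡ count𝒫 (avoids (ascending (3 + k))) (1 + n)
    + (count𝒫 (λ π → maxFirst π ∧ avoids (ascending (3 + k)) π) (1 + n)
    + count𝒫 (avoids (ascending (2 + k))) (1 + n))
ascending-recurrence k n =
  trans (count𝒫-insert (avoids ι) n)
        (cong₂ _+_ (count𝒫-cong (1 + n) front)
                   (cong₂ _+_ (count𝒫-cong (1 + n) middle) (count𝒫-cong (1 + n) end)))
  where
  ι = ascending (3 + k)
  front : π ↭ applyDownFrom suc (1 + n) → avoids ι (2 + n ∷ π) ≡ avoids ι π
  front π↭ = cong not (ascending-∷-max {k = 1 + k} (↭-downFrom-below π↭))
  middle : π ↭ applyDownFrom suc (1 + n) → maxFirst π ∧ avoids ι (insert₂ (2 + n) π) ≡ maxFirst π ∧ avoids ι π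
  middle π↭ = maxFirst-insert₂-cong {R = avoids ι} {R′ = avoids ι}
                (λ h<m π<h → cong not (ascending-insert₂ {k = k} h<m π<h)) (↭-downFrom-below π↭)
  end : π ↭ applyDownFrom suc (1 + n) → avoids ι (π ++ [ 2 + n ]) ≡ avoids (ascending (2 + k)) π
  end π↭ = cong not (ascending-∷ʳ-max {k = 2 + k} (↭-downFrom-below π↭))

maxFirst-ascending-recurrence : ∀ k n →
  count𝒫 (λ π → maxFirst π ∧ avoids (ascending (2 + k)) π) (2 + n) ≡ count𝒫 (avoids (ascending (2 + k))) (1 + n)
maxFirst-ascending-recurrence k n = trans (count𝒫-maxFirst (avoids (ascending (2 + k))) n)
  (count𝒫-cong (1 + n) λ π↭ → cong not (ascending-∷-max {k = k} (↭-downFrom-below π↭)))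

ascending-2-recurrence : ∀ n → count𝒫 (avoids (ascending 2)) (2 + n) ≡ count𝒫 (avoids (ascending 2)) (1 + n)
ascending-2-recurrence n = begin
  count𝒫 (avoids (ascending 2)) (2 + n)
    ≡⟨ count𝒫-insert (avoids (ascending 2)) n ⟩
  _ ≡⟨ cong₂ _+_ (count𝒫-cong (1 + n) λ π↭ → cong not (ascending-∷-max {k = 0} (↭-downFrom-below π↭)))
                 (cong₂ _+_ (count𝒫-none (1 + n) middle) (count𝒫-none (1 + n) end)) ⟩
  count𝒫 (avoids (ascending 2)) (1 + n) + 0
    ≡⟨ +-identityʳ _ ⟩
  count𝒫 (avoids (ascending 2)) (1 + n) ∎
  where
  open ≡-Reasoning
  middle : π ↭ applyDownFrom suc (1 + n) → maxFirst π ∧ avoids (ascending 2) (insert₂ (2 + n) π) ≡ false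
  middle {[]}    _  = refl
  middle {h ∷ π} π↭ rewrite contains-ascending-2 {π = π} (All.head (↭-downFrom-below π↭)) = ∧-zeroʳ _
  end : π ↭ applyDownFrom suc (1 + n) → avoids (ascending 2) (π ++ [ 2 + n ]) ≡ false
  end {[]}    π↭ with () ← ↭-downFrom-length π↭
  end {x ∷ π} π↭ rewrite ascending-∷ʳ-max {k = 1} (↭-downFrom-below π↭) | contains-ascending-1 {x} {π} = refl

ascending-1-count : ∀ n → count𝒫 (avoids (ascending 1)) (1 + n) ≡ 0
ascending-1-count n = count𝒫-none (1 + n) nonempty
  where
  nonempty : π ↭ applyDownFrom suc (1 + n) → avoids (ascending 1) π ≡ false
  nonempty {[]}    π↭ with () ← ↭-downFrom-length π↭
  nonempty {x ∷ π} _  = cong not (contains-ascending-1 {x} {π})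

-- Power series

-- shift is multiplication by x, δ is the series 1, and p ◃ f is the product p(x) f(x).

module ≗-Reasoning = SetoidReasoning (ℕ →-setoid ℤ)

infixl 6 _+ₛ_ _-ₛ_
infix  8 -ₛ_
infixr 7 _◃_

_+ₛ_ _-ₛ_ : Series → Series → Series
(f +ₛ g) n = f n ℤ.+ g n
(f -ₛ g) n = f n ℤ.- g n

-ₛ_ : Series → Series
(-ₛ f) n = ℤ.- f n

scale : ℤ → Series → Series
scale a f n = a ℤ.* f n

shift : Series → Series
shift f zero    = + 0
shift f (suc n) = f n

δ : Series
δ zero    = + 1
δ (suc _) = + 0

_◃_ : Poly → Series → Series
([]      ◃ f) n = + 0
((a ∷ p) ◃ f) n = a ℤ.* f n ℤ.+ shift (p ◃ f) n

⟦_⟧ : Poly → Series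
⟦ p ⟧ = p ◃ δ

≗-trans : ∀ {f g h : Series} → f ≗ g → g ≗ h → f ≗ h
≗-trans e e′ n = trans (e n) (e′ n)

+ₛ-cong : ∀ {f f′ g g′ : Series} → f ≗ f′ → g ≗ g′ → f +ₛ g ≗ f′ +ₛ g′
+ₛ-cong e e′ n = cong₂ ℤ._+_ (e n) (e′ n)

+ₛ-congˡ : ∀ {f f′ : Series} g → f ≗ f′ → f +ₛ g ≗ f′ +ₛ g
+ₛ-congˡ g e n = cong (ℤ._+ g n) (e n)

+ₛ-congʳ : ∀ f {g g′ : Series} → g ≗ g′ → f +ₛ g ≗ f +ₛ g′
+ₛ-congʳ f e n = cong (ℤ._+_ (f n)) (e n)

shift-cong : ∀ {f g} → f ≗ g → shift f ≗ shift g
shift-cong e zero    = refl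
shift-cong e (suc n) = e n

shift-+ₛ : ∀ f g → shift (f +ₛ g) ≗ shift f +ₛ shift g
shift-+ₛ f g zero    = refl
shift-+ₛ f g (suc n) = refl

shift--ₛ : ∀ f g → shift (f -ₛ g) ≗ shift f -ₛ shift g
shift--ₛ f g zero    = refl
shift--ₛ f g (suc n) = refl

shift-scale : ∀ a f → shift (scale a f) ≗ scale a (shift f)
shift-scale a f zero    = sym (ℤ.*-zeroʳ a)
shift-scale a f (suc n) = refl

◃-cong : ∀ p {f g} → f ≗ g → p ◃ f ≗ p ◃ g
◃-cong []      e n = refl
◃-cong (a ∷ p) e n = cong₂ ℤ._+_ (cong (a ℤ.*_) (e n)) (shift-cong (◃-cong p e) n)

◃-zero : ∀ p → p ◃ (λ _ → + 0) ≗ (λ _ → + 0)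
◃-zero []      n       = refl
◃-zero (a ∷ p) zero    = cong (ℤ._+ + 0) (ℤ.*-zeroʳ a)
◃-zero (a ∷ p) (suc n) = cong₂ ℤ._+_ (ℤ.*-zeroʳ a) (◃-zero p n)

◃-shift : ∀ p f → p ◃ shift f ≗ shift (p ◃ f)
◃-shift []      f zero    = refl
◃-shift []      f (suc n) = refl
◃-shift (a ∷ p) f zero    = cong (ℤ._+ + 0) (ℤ.*-zeroʳ a)
◃-shift (a ∷ p) f (suc n) = cong (ℤ._+_ (a ℤ.* f n)) (◃-shift p f n)

◃-+ₛ : ∀ p f g → p ◃ (f +ₛ g) ≗ p ◃ f +ₛ p ◃ g
◃-+ₛ []      f g n = refl
◃-+ₛ (a ∷ p) f g n rewrite shift-cong (◃-+ₛ p f g) n | shift-+ₛ (p ◃ f) (p ◃ g) n =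
  solve 5 (λ a x y u v → a :* (x :+ y) :+ (u :+ v) := (a :* x :+ u) :+ (a :* y :+ v)) refl
    a (f n) (g n) (shift (p ◃ f) n) (shift (p ◃ g) n)
  where open ℤ-Solver.+-*-Solver

◃--ₛ : ∀ p f g → p ◃ (f -ₛ g) ≗ p ◃ f -ₛ p ◃ g
◃--ₛ []      f g n = refl
◃--ₛ (a ∷ p) f g n rewrite shift-cong (◃--ₛ p f g) n | shift--ₛ (p ◃ f) (p ◃ g) n =
  solve 5 (λ a x y u v → a :* (x :- y) :+ (u :- v) := (a :* x :+ u) :- (a :* y :+ v)) refl
    a (f n) (g n) (shift (p ◃ f) n) (shift (p ◃ g) n)
  where open ℤ-Solver.+-*-Solver

◃-scale : ∀ p a f → p ◃ scale a f ≗ scale a (p ◃ f)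
◃-scale []      a f n = sym (ℤ.*-zeroʳ a)
◃-scale (b ∷ p) a f n rewrite shift-cong (◃-scale p a f) n | shift-scale a (p ◃ f) n =
  solve 4 (λ a b x u → b :* (a :* x) :+ a :* u := a :* (b :* x :+ u)) refl a b (f n) (shift (p ◃ f) n)
  where open ℤ-Solver.+-*-Solver

◃-⊕ : ∀ p q f → (p ⊕ q) ◃ f ≗ p ◃ f +ₛ q ◃ f
◃-⊕ []      q       f n = sym (ℤ.+-identityˡ _)
◃-⊕ (a ∷ p) []      f n = sym (ℤ.+-identityʳ _)
◃-⊕ (a ∷ p) (b ∷ q) f n rewrite shift-cong (◃-⊕ p q f) n | shift-+ₛ (p ◃ f) (q ◃ f) n =
  solve 5 (λ a b x u v → (a :+ b) :* x :+ (u :+ v) := (a :* x :+ u) :+ (b :* x :+ v)) refl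
    a b (f n) (shift (p ◃ f) n) (shift (q ◃ f) n)
  where open ℤ-Solver.+-*-Solver

◃-map-scale : ∀ a q f → map (a ℤ.*_) q ◃ f ≗ scale a (q ◃ f)
◃-map-scale a []      f n = sym (ℤ.*-zeroʳ a)
◃-map-scale a (b ∷ q) f n rewrite shift-cong (◃-map-scale a q f) n | shift-scale a (q ◃ f) n =
  solve 4 (λ a b x u → a :* b :* x :+ a :* u := a :* (b :* x :+ u)) refl a b (f n) (shift (q ◃ f) n)
  where open ℤ-Solver.+-*-Solver

◃-⊗ : ∀ p q f → (p ⊗ q) ◃ f ≗ p ◃ q ◃ f
◃-⊗ []      q f n = refl
◃-⊗ (a ∷ p) q f n rewrite ◃-⊕ (map (a ℤ.*_) q) (+ 0 ∷ (p ⊗ q)) f n | ◃-map-scale a q f n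
  | shift-cong (◃-⊗ p q f) n = cong (ℤ._+_ (a ℤ.* (q ◃ f) n)) (ℤ.+-identityˡ _)

◃-comm : ∀ p q f → p ◃ q ◃ f ≗ q ◃ p ◃ f
◃-comm []      q f n = sym (trans (◃-cong q {[] ◃ f} (λ _ → refl) n) (◃-zero q n))
◃-comm (a ∷ p) q f n = begin
  a ℤ.* (q ◃ f) n ℤ.+ shift (p ◃ q ◃ f) n  ≡⟨ cong (ℤ._+_ (a ℤ.* (q ◃ f) n)) (shift-cong (◃-comm p q f) n) ⟩
  a ℤ.* (q ◃ f) n ℤ.+ shift (q ◃ p ◃ f) n  ≡⟨ sym (cong₂ ℤ._+_ (◃-scale q a f n) (◃-shift q (p ◃ f) n)) ⟩
  (q ◃ scale a f +ₛ q ◃ shift (p ◃ f)) n  ≡⟨ sym (◃-+ₛ q (scale a f) (shift (p ◃ f)) n) ⟩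
  (q ◃ (a ∷ p) ◃ f) n                      ∎
  where open ≡-Reasoning

◃-𝟙 : ∀ f → 𝟙 ◃ f ≗ f
◃-𝟙 f zero    = trans (ℤ.+-identityʳ _) (ℤ.*-identityˡ (f zero))
◃-𝟙 f (suc n) = trans (ℤ.+-identityʳ _) (ℤ.*-identityˡ (f (suc n)))

◃-X : ∀ f → X ◃ f ≗ shift f
◃-X f zero    = refl
◃-X f (suc n) = trans (cong₂ ℤ._+_ (ℤ.*-zeroˡ (f (suc n))) (◃-𝟙 f n)) (ℤ.+-identityˡ (f n))

shift-neg : ∀ f → shift (-ₛ f) ≗ -ₛ shift f
shift-neg f zero    = refl
shift-neg f (suc n) = refl

◃-negP : ∀ p f → negP p ◃ f ≗ -ₛ (p ◃ f)
◃-negP []      f n = refl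
◃-negP (a ∷ p) f n rewrite shift-cong (◃-negP p f) n | shift-neg (p ◃ f) n =
  solve 3 (λ a x u → (:- a) :* x :+ (:- u) := :- (a :* x :+ u)) refl a (f n) (shift (p ◃ f) n)
  where open ℤ-Solver.+-*-Solver

sumTo-suc : ∀ n (g : ℕ → ℤ) → sumTo (suc n) g ≡ g 0 ℤ.+ sumTo n (λ i → g (suc i))
sumTo-suc zero    g = refl
sumTo-suc (suc n) g rewrite sumTo-suc n g = ℤ.+-assoc (g 0) (sumTo n (λ i → g (suc i))) (g (2 + n))

sumTo-cong : ∀ n {g g′ : ℕ → ℤ} → (∀ i → g i ≡ g′ i) → sumTo n g ≡ sumTo n g′
sumTo-cong zero    e = e 0
sumTo-cong (suc n) e = cong₂ ℤ._+_ (sumTo-cong n e) (e (suc n))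

sumTo-zero : ∀ n (g : ℕ → ℤ) → (∀ i → g i ≡ + 0) → sumTo n g ≡ + 0
sumTo-zero zero    g z = z 0
sumTo-zero (suc n) g z rewrite sumTo-zero n g z | z (suc n) = refl

·ₛ≗◃ : ∀ p f → p ·ₛ f ≗ p ◃ f
·ₛ≗◃ []      f n       = sumTo-zero n _ (λ i → ℤ.*-zeroˡ (f (n ∸ i)))
·ₛ≗◃ (a ∷ p) f zero    = sym (ℤ.+-identityʳ (a ℤ.* f 0))
·ₛ≗◃ (a ∷ p) f (suc n) = trans (sumTo-suc n _) (cong (ℤ._+_ (a ℤ.* f (suc n))) (·ₛ≗◃ p f n))

coeff≗⟦⟧ : ∀ p → coeff p ≗ ⟦ p ⟧
coeff≗⟦⟧ []      n       = refl
coeff≗⟦⟧ (a ∷ p) zero    = sym (trans (ℤ.+-identityʳ _) (ℤ.*-identityʳ a))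
coeff≗⟦⟧ (a ∷ p) (suc n) =
  sym (trans (cong₂ ℤ._+_ (ℤ.*-zeroʳ a) (sym (coeff≗⟦⟧ p n))) (ℤ.+-identityˡ _))

·ₛ-coeff-cong : ∀ p q f → coeff p ≗ coeff q → p ·ₛ f ≗ q ·ₛ f
·ₛ-coeff-cong p q f e n = sumTo-cong n (λ i → cong (ℤ._* f (n ∸ i)) (e i))

≡N/D-from-◃ : ∀ N D f → D ◃ f ≗ ⟦ N ⟧ → f ≡N/D (N , D)
≡N/D-from-◃ N D f e n = trans (·ₛ≗◃ D f n) (trans (e n) (sym (coeff≗⟦⟧ N n)))

1-x 1-x-x² : Poly
1-x    = 𝟙 ⊕ negP X
1-x-x² = 𝟙 ⊕ negP X ⊕ negP (X ^ᴾ 2)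

X²◃ : ∀ f → X ^ᴾ 2 ◃ f ≗ shift (shift f)
X²◃ f n = begin
  (X ^ᴾ 2 ◃ f) n           ≡⟨ ◃-⊗ X (X ⊗ 𝟙) f n ⟩
  (X ◃ (X ⊗ 𝟙) ◃ f) n      ≡⟨ ◃-X _ n ⟩
  shift ((X ⊗ 𝟙) ◃ f) n    ≡⟨ shift-cong (λ i → trans (◃-⊗ X 𝟙 f i) (trans (◃-X _ i) (shift-cong (◃-𝟙 f) i))) n ⟩
  shift (shift f) n        ∎
  where open ≡-Reasoning

1-x◃ : ∀ f → 1-x ◃ f ≗ f -ₛ shift f
1-x◃ f n =
  trans (◃-⊕ 𝟙 (negP X) f n) (cong₂ ℤ._+_ (◃-𝟙 f n) (trans (◃-negP X f n) (cong ℤ.-_ (◃-X f n))))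

1-x-x²◃ : ∀ f → 1-x-x² ◃ f ≗ f -ₛ shift f -ₛ shift (shift f)
1-x-x²◃ f n =
  trans (◃-⊕ 1-x (negP (X ^ᴾ 2)) f n)
        (cong₂ ℤ._+_ (1-x◃ f n) (trans (◃-negP (X ^ᴾ 2) f n) (cong ℤ.-_ (X²◃ f n))))

1+x◃ : ∀ f → (𝟙 ⊕ X) ◃ f ≗ f +ₛ shift f
1+x◃ f n = trans (◃-⊕ 𝟙 X f n) (cong₂ ℤ._+_ (◃-𝟙 f n) (◃-X f n))

1-x²◃ : ∀ f → (𝟙 ⊕ negP (X ^ᴾ 2)) ◃ f ≗ f -ₛ shift (shift f)
1-x²◃ f n =
  trans (◃-⊕ 𝟙 (negP (X ^ᴾ 2)) f n)
        (cong₂ ℤ._+_ (◃-𝟙 f n) (trans (◃-negP (X ^ᴾ 2) f n) (cong ℤ.-_ (X²◃ f n))))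

-- Generating functions

genPᵐ : List ℕ → Series
genPᵐ σ n = + count𝒫 (λ π → maxFirst π ∧ avoids σ π) n

genPᵐ≗shift : ∀ σ τ → count𝒫 (avoids τ) 0 ≡ 1 →
              (∀ n → count𝒫 (λ π → maxFirst π ∧ avoids σ π) (2 + n) ≡ count𝒫 (avoids τ) (1 + n)) →
              genPᵐ σ ≗ shift (genP τ -ₛ δ)
genPᵐ≗shift σ τ e₀ e zero          = refl
genPᵐ≗shift σ τ e₀ e (suc zero)    = cong (λ c → + c ℤ.- + 1) (sym e₀)
genPᵐ≗shift σ τ e₀ e (suc (suc n)) = trans (cong +_ (e n)) (sym (ℤ.+-identityʳ _))

pos-+³ : ∀ a b c → + (a + (b + c)) ≡ + a ℤ.+ (+ b ℤ.+ + c)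
pos-+³ a b c = trans (ℤ.pos-+ a (b + c)) (cong (ℤ._+_ (+ a)) (ℤ.pos-+ b c))

genPᵐ-dPattern : ∀ j → genPᵐ (dPattern (2 + j)) ≗ shift (genP (ascending (1 + j)) -ₛ δ)
genPᵐ-dPattern j = genPᵐ≗shift (dPattern (2 + j)) (ascending (1 + j)) refl (maxFirst-dPattern-recurrence j)

genPᵐ-ascending : ∀ k → genPᵐ (ascending (2 + k)) ≗ shift (genP (ascending (2 + k)) -ₛ δ)
genPᵐ-ascending k = genPᵐ≗shift (ascending (2 + k)) (ascending (2 + k)) refl (maxFirst-ascending-recurrence k)

dPattern-equation : ∀ j → let g = genP (ascending (1 + j)) -ₛ δ in
                    1-x ◃ genP (dPattern (2 + j)) ≗ δ +ₛ shift g +ₛ shift (shift g)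
dPattern-equation j = ≗-trans (1-x◃ F) step
  where
  F G : Series
  F = genP (dPattern (2 + j))
  G = genP (ascending (1 + j))
  step : F -ₛ shift F ≗ δ +ₛ shift (G -ₛ δ) +ₛ shift (shift (G -ₛ δ))
  step zero          = refl
  step (suc zero)    = refl
  step (suc (suc n)) = begin
    F (2 + n) ℤ.- F (1 + n)
      ≡⟨ cong (λ c → + c ℤ.- F (1 + n)) (dPattern-recurrence j n) ⟩
    + (cG + (cM + cF)) ℤ.- F (1 + n)
      ≡⟨ cong (ℤ._- F (1 + n)) (pos-+³ cG cM cF) ⟩
    G (1 + n) ℤ.+ (genPᵐ (dPattern (2 + j)) (1 + n) ℤ.+ F (1 + n)) ℤ.- F (1 + n)
      ≡⟨ cong (λ z → G (1 + n) ℤ.+ (z ℤ.+ F (1 + n)) ℤ.- F (1 + n)) (genPᵐ-dPattern j (1 + n)) ⟩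
    G (1 + n) ℤ.+ ((G -ₛ δ) n ℤ.+ F (1 + n)) ℤ.- F (1 + n)
      ≡⟨ solve 3 (λ a b c → a :+ (b :+ c) :- c := con (+ 0) :+ (a :- con (+ 0)) :+ b) refl
           (G (1 + n)) ((G -ₛ δ) n) (F (1 + n)) ⟩
    + 0 ℤ.+ (G (1 + n) ℤ.- + 0) ℤ.+ (G -ₛ δ) n ∎
    where
    open ≡-Reasoning
    open ℤ-Solver.+-*-Solver
    cG = count𝒫 (avoids (ascending (1 + j))) (1 + n)
    cM = count𝒫 (λ π → maxFirst π ∧ avoids (dPattern (2 + j)) π) (1 + n)
    cF = count𝒫 (avoids (dPattern (2 + j))) (1 + n)

ascending-1-equation : genP (ascending 1) ≗ δ
ascending-1-equation zero    = refl
ascending-1-equation (suc n) = cong +_ (ascending-1-count n)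

ascending-2-equation : 1-x ◃ genP (ascending 2) ≗ δ
ascending-2-equation = ≗-trans (1-x◃ G) step
  where
  G : Series
  G = genP (ascending 2)
  step : G -ₛ shift G ≗ δ
  step zero          = refl
  step (suc zero)    = refl
  step (suc (suc n)) =
    trans (cong (λ c → + c ℤ.- G (1 + n)) (ascending-2-recurrence n)) (ℤ.+-inverseʳ (G (1 + n)))

ascending-equation : ∀ k → 1-x-x² ◃ genP (ascending (3 + k)) ≗ ⟦ 1-x-x² ⟧ +ₛ shift (genP (ascending (2 + k)))
ascending-equation k = ≗-trans (1-x-x²◃ G) (≗-trans step (+ₛ-congˡ (shift G′) (λ n → sym (1-x-x²◃ δ n))))
  where
  G G′ : Series
  G  = genP (ascending (3 + k))
  G′ = genP (ascending (2 + k))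
  step : G -ₛ shift G -ₛ shift (shift G) ≗ (δ -ₛ shift δ -ₛ shift (shift δ)) +ₛ shift G′
  step zero          = refl
  step (suc zero)    = refl
  step (suc (suc n)) = begin
    G (2 + n) ℤ.- G (1 + n) ℤ.- G n
      ≡⟨ cong (λ c → + c ℤ.- G (1 + n) ℤ.- G n) (ascending-recurrence k n) ⟩
    + (cG + (cM + cG′)) ℤ.- G (1 + n) ℤ.- G n
      ≡⟨ cong (λ z → z ℤ.- G (1 + n) ℤ.- G n) (pos-+³ cG cM cG′) ⟩
    G (1 + n) ℤ.+ (genPᵐ (ascending (3 + k)) (1 + n) ℤ.+ G′ (1 + n)) ℤ.- G (1 + n) ℤ.- G n
      ≡⟨ cong (λ z → G (1 + n) ℤ.+ (z ℤ.+ G′ (1 + n)) ℤ.- G (1 + n) ℤ.- G n)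
              (genPᵐ-ascending (1 + k) (1 + n)) ⟩
    G (1 + n) ℤ.+ (G n ℤ.- δ n ℤ.+ G′ (1 + n)) ℤ.- G (1 + n) ℤ.- G n
      ≡⟨ solve 4 (λ a b d c → a :+ (b :- d :+ c) :- a :- b := con (+ 0) :- con (+ 0) :- d :+ c) refl
           (G (1 + n)) (G n) (δ n) (G′ (1 + n)) ⟩
    + 0 ℤ.- + 0 ℤ.- δ n ℤ.+ G′ (1 + n) ∎
    where
    open ≡-Reasoning
    open ℤ-Solver.+-*-Solver
    cG  = count𝒫 (avoids (ascending (3 + k))) (1 + n)
    cM  = count𝒫 (λ π → maxFirst π ∧ avoids (ascending (3 + k)) π) (1 + n)
    cG′ = count𝒫 (avoids (ascending (2 + k))) (1 + n)

Q : ℕ → Poly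
Q k = sumP k (λ r → 1-x-x² ^ᴾ (r + 1) ⊗ X ^ᴾ (k ∸ r))

⟦⊗X⟧ : ∀ p q → ⟦ p ⊗ (X ⊗ q) ⟧ ≗ shift ⟦ p ⊗ q ⟧
⟦⊗X⟧ p q n = begin
  ⟦ p ⊗ (X ⊗ q) ⟧ n          ≡⟨ ◃-⊗ p (X ⊗ q) δ n ⟩
  (p ◃ (X ⊗ q) ◃ δ) n        ≡⟨ ◃-cong p (λ i → trans (◃-⊗ X q δ i) (◃-X ⟦ q ⟧ i)) n ⟩
  (p ◃ shift ⟦ q ⟧) n        ≡⟨ ◃-shift p ⟦ q ⟧ n ⟩
  shift (p ◃ ⟦ q ⟧) n        ≡⟨ shift-cong (λ i → sym (◃-⊗ p q δ i)) n ⟩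
  shift ⟦ p ⊗ q ⟧ n          ∎
  where open ≡-Reasoning

⟦sumP⟧-shift : ∀ m (F G : ℕ → Poly) → (∀ r → r < m → ⟦ F r ⟧ ≗ shift ⟦ G r ⟧) →
               ⟦ sumP m F ⟧ ≗ shift ⟦ sumP m G ⟧
⟦sumP⟧-shift zero    F G e zero    = refl
⟦sumP⟧-shift zero    F G e (suc n) = refl
⟦sumP⟧-shift (suc m) F G e n = begin
  ⟦ sumP m F ⊕ F m ⟧ n                        ≡⟨ ◃-⊕ (sumP m F) (F m) δ n ⟩
  ⟦ sumP m F ⟧ n ℤ.+ ⟦ F m ⟧ n
    ≡⟨ cong₂ ℤ._+_ (⟦sumP⟧-shift m F G (λ r r<m → e r (m<n⇒m<1+n r<m)) n) (e m (n<1+n m) n) ⟩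
  shift ⟦ sumP m G ⟧ n ℤ.+ shift ⟦ G m ⟧ n    ≡⟨ sym (shift-+ₛ ⟦ sumP m G ⟧ ⟦ G m ⟧ n) ⟩
  shift (⟦ sumP m G ⟧ +ₛ ⟦ G m ⟧) n           ≡⟨ shift-cong (λ i → sym (◃-⊕ (sumP m G) (G m) δ i)) n ⟩
  shift ⟦ sumP m G ⊕ G m ⟧ n                  ∎
  where open ≡-Reasoning

Q-suc : ∀ k → ⟦ Q (suc k) ⟧ ≗ shift ⟦ Q k ⟧ +ₛ shift ⟦ 1-x-x² ^ᴾ suc k ⟧
Q-suc k n = begin
  ⟦ sumP k F′ ⊕ F′ k ⟧ n                              ≡⟨ ◃-⊕ (sumP k F′) (F′ k) δ n ⟩
  ⟦ sumP k F′ ⟧ n ℤ.+ ⟦ F′ k ⟧ n                      ≡⟨ cong₂ ℤ._+_ (⟦sumP⟧-shift k F′ F earlier n) last ⟩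
  shift ⟦ Q k ⟧ n ℤ.+ shift ⟦ 1-x-x² ^ᴾ suc k ⟧ n      ∎
  where
  open ≡-Reasoning
  F F′ : ℕ → Poly
  F  r = 1-x-x² ^ᴾ (r + 1) ⊗ X ^ᴾ (k ∸ r)
  F′ r = 1-x-x² ^ᴾ (r + 1) ⊗ X ^ᴾ (suc k ∸ r)
  earlier : ∀ r → r < k → ⟦ F′ r ⟧ ≗ shift ⟦ F r ⟧
  earlier r r<k rewrite +-∸-assoc 1 (<⇒≤ r<k) = ⟦⊗X⟧ (1-x-x² ^ᴾ (r + 1)) (X ^ᴾ (k ∸ r))
  last : ⟦ F′ k ⟧ n ≡ shift ⟦ 1-x-x² ^ᴾ suc k ⟧ n
  last rewrite m+n∸n≡m 1 k | +-comm k 1 =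
    trans (⟦⊗X⟧ (1-x-x² ^ᴾ suc k) 𝟙 n)
          (shift-cong (λ i → trans (◃-⊗ (1-x-x² ^ᴾ suc k) 𝟙 δ i) (◃-cong (1-x-x² ^ᴾ suc k) (◃-𝟙 δ) i)) n)

ascending-solution : ∀ k → shift ((1-x-x² ^ᴾ k ⊗ 1-x) ◃ genP (ascending (2 + k)))
                           ≗ ⟦ Q k ⟧ -ₛ shift ⟦ Q k ⟧ +ₛ ⟦ X ^ᴾ suc k ⟧
ascending-solution zero n = begin
  shift ((𝟙 ⊗ 1-x) ◃ G₂) n
    ≡⟨ shift-cong (λ i → trans (◃-⊗ 𝟙 1-x G₂ i) (trans (◃-𝟙 (1-x ◃ G₂) i) (ascending-2-equation i))) n ⟩
  shift δ n
    ≡⟨ boundary n ⟩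
  + 0 ℤ.- shift ⟦ [] ⟧ n ℤ.+ shift δ n
    ≡⟨ cong (ℤ._+_ (+ 0 ℤ.- shift ⟦ [] ⟧ n)) (trans (◃-⊗ X 𝟙 δ n) (trans (◃-X _ n) (shift-cong (◃-𝟙 δ) n))) ⟨
  + 0 ℤ.- shift ⟦ [] ⟧ n ℤ.+ ⟦ X ^ᴾ 1 ⟧ n ∎
  where
  open ≡-Reasoning
  G₂ = genP (ascending 2)
  boundary : ∀ n → shift δ n ≡ + 0 ℤ.- shift ⟦ [] ⟧ n ℤ.+ shift δ n
  boundary zero    = refl
  boundary (suc n) = sym (ℤ.+-identityˡ (δ n))
ascending-solution (suc k) n = begin
  shift ((A ^ᴾ suc k ⊗ 1-x) ◃ G) n
    ≡⟨ shift-cong reorder n ⟩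
  shift (Y ◃ (A ◃ G)) n
    ≡⟨ shift-cong (λ i → trans (◃-cong Y (ascending-equation k) i)
                               (trans (◃-+ₛ Y ⟦ A ⟧ (shift G′) i) (+ₛ-congʳ (Y ◃ ⟦ A ⟧) (◃-shift Y G′) i))) n ⟩
  shift (Y ◃ ⟦ A ⟧ +ₛ shift (Y ◃ G′)) n
    ≡⟨ shift-+ₛ (Y ◃ ⟦ A ⟧) (shift (Y ◃ G′)) n ⟩
  shift (Y ◃ ⟦ A ⟧) n ℤ.+ shift (shift (Y ◃ G′)) n
    ≡⟨ cong₂ ℤ._+_ (shift-cong (λ i → trans (Y◃A i) (1-x◃ aₖ i)) n) (shift-cong (ascending-solution k) n) ⟩
  shift (aₖ -ₛ shift aₖ) n ℤ.+ shift (qₖ -ₛ shift qₖ +ₛ zₖ) n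
    ≡⟨ cong₂ ℤ._+_ (shift--ₛ aₖ (shift aₖ) n)
                   (trans (shift-+ₛ (qₖ -ₛ shift qₖ) zₖ n) (cong (ℤ._+ shift zₖ n) (shift--ₛ qₖ (shift qₖ) n))) ⟩
  shift aₖ n ℤ.- shift (shift aₖ) n ℤ.+ (shift qₖ n ℤ.- shift (shift qₖ) n ℤ.+ shift zₖ n)
    ≡⟨ solve 5 (λ a a′ q q′ z → a :- a′ :+ (q :- q′ :+ z) := q :+ a :- (q′ :+ a′) :+ z) refl
         (shift aₖ n) (shift (shift aₖ) n) (shift qₖ n) (shift (shift qₖ) n) (shift zₖ n) ⟩
  shift qₖ n ℤ.+ shift aₖ n ℤ.- (shift (shift qₖ) n ℤ.+ shift (shift aₖ) n) ℤ.+ shift zₖ n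
    ≡⟨ cong₂ (λ u v → u ℤ.- v ℤ.+ shift zₖ n) (sym (Q-suc k n))
             (trans (sym (shift-+ₛ (shift qₖ) (shift aₖ) n)) (shift-cong (λ i → sym (Q-suc k i)) n)) ⟩
  ⟦ Q (suc k) ⟧ n ℤ.- shift ⟦ Q (suc k) ⟧ n ℤ.+ shift zₖ n
    ≡⟨ cong (ℤ._+_ (⟦ Q (suc k) ⟧ n ℤ.- shift ⟦ Q (suc k) ⟧ n)) (trans (◃-⊗ X (X ^ᴾ suc k) δ n) (◃-X zₖ n)) ⟨
  ⟦ Q (suc k) ⟧ n ℤ.- shift ⟦ Q (suc k) ⟧ n ℤ.+ ⟦ X ^ᴾ suc (suc k) ⟧ n ∎
  where
  open ≡-Reasoning
  open ℤ-Solver.+-*-Solver using (solve; _:+_; _:-_; _:*_; :-_; _:=_; con)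
  A = 1-x-x²
  Y = A ^ᴾ k ⊗ 1-x
  G  = genP (ascending (3 + k))
  G′ = genP (ascending (2 + k))
  aₖ qₖ zₖ : Series
  aₖ = ⟦ A ^ᴾ suc k ⟧
  qₖ = ⟦ Q k ⟧
  zₖ = ⟦ X ^ᴾ suc k ⟧
  reorder : (A ^ᴾ suc k ⊗ 1-x) ◃ G ≗ Y ◃ (A ◃ G)
  reorder i = trans (◃-⊗ (A ⊗ A ^ᴾ k) 1-x G i) (trans (◃-⊗ A (A ^ᴾ k) (1-x ◃ G) i)
    (trans (◃-cong A (λ j → sym (◃-⊗ (A ^ᴾ k) 1-x G j)) i) (◃-comm A Y G i)))
  Y◃A : Y ◃ ⟦ A ⟧ ≗ 1-x ◃ aₖ
  Y◃A i = trans (◃-⊗ (A ^ᴾ k) 1-x ⟦ A ⟧ i) (trans (◃-comm (A ^ᴾ k) 1-x ⟦ A ⟧ i)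
    (◃-cong 1-x (λ j → trans (◃-comm (A ^ᴾ k) A δ j) (sym (◃-⊗ A (A ^ᴾ k) δ j))) i))

shift-substitution : ∀ (u y q z : Series) → shift y ≗ q -ₛ shift q +ₛ z →
                     u +ₛ shift (y -ₛ u) +ₛ shift (shift (y -ₛ u))
                       ≗ (u -ₛ shift u -ₛ shift (shift u)) +ₛ (q -ₛ shift (shift q)) +ₛ (z +ₛ shift z)
shift-substitution u y q z sy n = begin
  u n ℤ.+ shift (y -ₛ u) n ℤ.+ shift (shift (y -ₛ u)) n
    ≡⟨ cong₂ (λ a b → u n ℤ.+ a ℤ.+ b) (shift--ₛ y u n)
             (trans (shift-cong (shift--ₛ y u) n) (shift--ₛ (shift y) (shift u) n)) ⟩
  u n ℤ.+ (shift y n ℤ.- shift u n) ℤ.+ (shift (shift y) n ℤ.- shift (shift u) n)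
    ≡⟨ cong₂ (λ a b → u n ℤ.+ (a ℤ.- shift u n) ℤ.+ (b ℤ.- shift (shift u) n)) (sy n) (shift-cong sy n) ⟩
  u n ℤ.+ ((q -ₛ shift q +ₛ z) n ℤ.- shift u n) ℤ.+ (shift (q -ₛ shift q +ₛ z) n ℤ.- shift (shift u) n)
    ≡⟨ cong (λ a → u n ℤ.+ ((q -ₛ shift q +ₛ z) n ℤ.- shift u n) ℤ.+ (a ℤ.- shift (shift u) n))
            (trans (shift-+ₛ (q -ₛ shift q) z n) (cong (ℤ._+ shift z n) (shift--ₛ q (shift q) n))) ⟩
  u n ℤ.+ (q n ℤ.- shift q n ℤ.+ z n ℤ.- shift u n)
    ℤ.+ (shift q n ℤ.- shift (shift q) n ℤ.+ shift z n ℤ.- shift (shift u) n)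
    ≡⟨ solve 8 (λ u u′ u″ q q′ q″ z z′ → u :+ (q :- q′ :+ z :- u′) :+ (q′ :- q″ :+ z′ :- u″)
                                        := (u :- u′ :- u″) :+ (q :- q″) :+ (z :+ z′)) refl
         (u n) (shift u n) (shift (shift u) n) (q n) (shift q n) (shift (shift q) n) (z n) (shift z n) ⟩
  (u n ℤ.- shift u n ℤ.- shift (shift u) n) ℤ.+ (q n ℤ.- shift (shift q) n) ℤ.+ (z n ℤ.+ shift z n) ∎
  where
  open ≡-Reasoning
  open ℤ-Solver.+-*-Solver using (solve; _:+_; _:-_; _:=_)

numerator : ℕ → Poly
numerator k = 1-x ⊗ 1-x-x² ^ᴾ suc k ⊕ (𝟙 ⊕ negP (X ^ᴾ 2)) ⊗ Q k ⊕ X ^ᴾ suc k ⊗ (𝟙 ⊕ X)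

dPattern-solution : ∀ k → (1-x ^ᴾ 2 ⊗ 1-x-x² ^ᴾ k) ◃ genP (dPattern (3 + k)) ≗ ⟦ numerator k ⟧
dPattern-solution k = begin
  (B ^ᴾ 2 ⊗ Aᵏ) ◃ F
    ≈⟨ reorder ⟩
  Y ◃ (B ◃ F)
    ≈⟨ ◃-cong Y (dPattern-equation (1 + k)) ⟩
  Y ◃ (δ +ₛ shift (G -ₛ δ) +ₛ shift (shift (G -ₛ δ)))
    ≈⟨ distribute ⟩
  u +ₛ shift (Y ◃ G -ₛ u) +ₛ shift (shift (Y ◃ G -ₛ u))
    ≈⟨ shift-substitution u (Y ◃ G) ⟦ Q k ⟧ z (ascending-solution k) ⟩
  (u -ₛ shift u -ₛ shift (shift u)) +ₛ (⟦ Q k ⟧ -ₛ shift (shift ⟦ Q k ⟧)) +ₛ (z +ₛ shift z)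
    ≈⟨ collect ⟩
  ⟦ numerator k ⟧ ∎
  where
  open ≗-Reasoning
  A B Aᵏ Y : Poly
  A  = 1-x-x²
  B  = 1-x
  Aᵏ = A ^ᴾ k
  Y  = Aᵏ ⊗ B
  F G u z : Series
  F = genP (dPattern (3 + k))
  G = genP (ascending (2 + k))
  u = ⟦ Y ⟧
  z = ⟦ X ^ᴾ suc k ⟧
  reorder : (B ^ᴾ 2 ⊗ Aᵏ) ◃ F ≗ Y ◃ (B ◃ F)
  reorder = begin
    (B ^ᴾ 2 ⊗ Aᵏ) ◃ F      ≈⟨ ◃-⊗ (B ^ᴾ 2) Aᵏ F ⟩
    B ^ᴾ 2 ◃ Aᵏ ◃ F        ≈⟨ ◃-⊗ B (B ⊗ 𝟙) (Aᵏ ◃ F) ⟩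
    B ◃ (B ⊗ 𝟙) ◃ Aᵏ ◃ F   ≈⟨ ◃-cong B (λ i → trans (◃-⊗ B 𝟙 (Aᵏ ◃ F) i) (◃-cong B (◃-𝟙 (Aᵏ ◃ F)) i)) ⟩
    B ◃ B ◃ Aᵏ ◃ F         ≈⟨ ◃-cong B (◃-comm B Aᵏ F) ⟩
    B ◃ Aᵏ ◃ B ◃ F         ≈⟨ ◃-comm B Aᵏ (B ◃ F) ⟩
    Aᵏ ◃ B ◃ B ◃ F         ≈⟨ ◃-⊗ Aᵏ B (B ◃ F) ⟨
    Y ◃ B ◃ F              ∎
  distribute : Y ◃ (δ +ₛ shift (G -ₛ δ) +ₛ shift (shift (G -ₛ δ)))
               ≗ u +ₛ shift (Y ◃ G -ₛ u) +ₛ shift (shift (Y ◃ G -ₛ u))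
  distribute = begin
    Y ◃ (δ +ₛ shift g +ₛ shift (shift g))
      ≈⟨ ◃-+ₛ Y (δ +ₛ shift g) (shift (shift g)) ⟩
    Y ◃ (δ +ₛ shift g) +ₛ Y ◃ shift (shift g)
      ≈⟨ +ₛ-cong (◃-+ₛ Y δ (shift g)) (λ i → trans (◃-shift Y (shift g) i) (shift-cong (◃-shift Y g) i)) ⟩
    u +ₛ Y ◃ shift g +ₛ shift (shift (Y ◃ g))
      ≈⟨ +ₛ-congˡ (shift (shift (Y ◃ g))) (+ₛ-congʳ u (◃-shift Y g)) ⟩
    u +ₛ shift (Y ◃ g) +ₛ shift (shift (Y ◃ g))
      ≈⟨ +ₛ-cong (+ₛ-congʳ u (shift-cong (◃--ₛ Y G δ))) (shift-cong (shift-cong (◃--ₛ Y G δ))) ⟩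
    u +ₛ shift (Y ◃ G -ₛ u) +ₛ shift (shift (Y ◃ G -ₛ u)) ∎
    where
    g = G -ₛ δ
  collect : (u -ₛ shift u -ₛ shift (shift u)) +ₛ (⟦ Q k ⟧ -ₛ shift (shift ⟦ Q k ⟧)) +ₛ (z +ₛ shift z)
            ≗ ⟦ numerator k ⟧
  collect = begin
    (u -ₛ shift u -ₛ shift (shift u)) +ₛ (⟦ Q k ⟧ -ₛ shift (shift ⟦ Q k ⟧)) +ₛ (z +ₛ shift z)
      ≈⟨ +ₛ-cong (+ₛ-cong (1-x-x²◃ u) (1-x²◃ ⟦ Q k ⟧)) (1+x◃ z) ⟨
    A ◃ u +ₛ (𝟙 ⊕ negP (X ^ᴾ 2)) ◃ ⟦ Q k ⟧ +ₛ (𝟙 ⊕ X) ◃ z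
      ≈⟨ +ₛ-cong (+ₛ-cong first (λ i → sym (◃-⊗ (𝟙 ⊕ negP (X ^ᴾ 2)) (Q k) δ i))) third ⟩
    ⟦ B ⊗ A ^ᴾ suc k ⟧ +ₛ ⟦ (𝟙 ⊕ negP (X ^ᴾ 2)) ⊗ Q k ⟧ +ₛ ⟦ X ^ᴾ suc k ⊗ (𝟙 ⊕ X) ⟧
      ≈⟨ ≗-trans (◃-⊕ (B ⊗ A ^ᴾ suc k ⊕ (𝟙 ⊕ negP (X ^ᴾ 2)) ⊗ Q k) (X ^ᴾ suc k ⊗ (𝟙 ⊕ X)) δ)
                 (+ₛ-congˡ ⟦ X ^ᴾ suc k ⊗ (𝟙 ⊕ X) ⟧ (◃-⊕ (B ⊗ A ^ᴾ suc k) ((𝟙 ⊕ negP (X ^ᴾ 2)) ⊗ Q k) δ)) ⟨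
    ⟦ numerator k ⟧ ∎
    where
    first : A ◃ u ≗ ⟦ B ⊗ A ^ᴾ suc k ⟧
    first = begin
      A ◃ (Aᵏ ⊗ B) ◃ δ     ≈⟨ ◃-cong A (◃-⊗ Aᵏ B δ) ⟩
      A ◃ Aᵏ ◃ B ◃ δ       ≈⟨ ◃-⊗ A Aᵏ (B ◃ δ) ⟨
      (A ⊗ Aᵏ) ◃ B ◃ δ     ≈⟨ ◃-comm (A ⊗ Aᵏ) B δ ⟩
      B ◃ (A ⊗ Aᵏ) ◃ δ     ≈⟨ ◃-⊗ B (A ⊗ Aᵏ) δ ⟨
      ⟦ B ⊗ A ^ᴾ suc k ⟧   ∎
    third : (𝟙 ⊕ X) ◃ z ≗ ⟦ X ^ᴾ suc k ⊗ (𝟙 ⊕ X) ⟧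
    third = begin
      (𝟙 ⊕ X) ◃ X ^ᴾ suc k ◃ δ   ≈⟨ ◃-comm (𝟙 ⊕ X) (X ^ᴾ suc k) δ ⟩
      X ^ᴾ suc k ◃ (𝟙 ⊕ X) ◃ δ   ≈⟨ ◃-⊗ (X ^ᴾ suc k) (𝟙 ⊕ X) δ ⟨
      ⟦ X ^ᴾ suc k ⊗ (𝟙 ⊕ X) ⟧   ∎

gf-21 : genP (2 ∷ 1 ∷ []) ≡N/D (𝟙 , 1-x)
gf-21 = ≡N/D-from-◃ 𝟙 1-x (genP (2 ∷ 1 ∷ [])) equation
  where
  equation : 1-x ◃ genP (dPattern 2) ≗ ⟦ 𝟙 ⟧
  equation zero          = refl
  equation (suc zero)    = refl
  equation (suc (suc n)) = begin
    (1-x ◃ genP (dPattern 2)) (2 + n)                  ≡⟨ dPattern-equation 0 (2 + n) ⟩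
    + 0 ℤ.+ (G₁ (1 + n) ℤ.- + 0) ℤ.+ (G₁ n ℤ.- δ n)    ≡⟨ cong₂ (λ a b → + 0 ℤ.+ (a ℤ.- + 0) ℤ.+ (b ℤ.- δ n))
                                                              (ascending-1-equation (1 + n)) (ascending-1-equation n) ⟩
    + 0 ℤ.+ (δ n ℤ.- δ n)                              ≡⟨ trans (ℤ.+-identityˡ _) (ℤ.+-inverseʳ (δ n)) ⟩
    + 0                                                ∎
    where
    open ≡-Reasoning
    G₁ = genP (ascending 1)

gf-dPattern : ∀ k → genP (dPattern (3 + k)) ≡N/D (numerator k , 1-x ^ᴾ 2 ⊗ 1-x-x² ^ᴾ k)
gf-dPattern k =
  ≡N/D-from-◃ (numerator k) (1-x ^ᴾ 2 ⊗ 1-x-x² ^ᴾ k) (genP (dPattern (3 + k))) (dPattern-solution k)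

gf-312 : genP (3 ∷ 1 ∷ 2 ∷ []) ≡N/D (1-x-x² ⊗ 1-x ⊕ X ⊗ (𝟙 ⊕ X) , 1-x ^ᴾ 2)
gf-312 n = begin
  ((1-x ^ᴾ 2) ·ₛ F) n                   ≡⟨ ·ₛ-coeff-cong (1-x ^ᴾ 2 ⊗ 1-x-x² ^ᴾ 0) (1-x ^ᴾ 2) F same-denominator n ⟨
  ((1-x ^ᴾ 2 ⊗ 1-x-x² ^ᴾ 0) ·ₛ F) n     ≡⟨ gf-dPattern 0 n ⟩
  coeff (numerator 0) n                  ≡⟨ same-numerator n ⟩
  coeff (1-x-x² ⊗ 1-x ⊕ X ⊗ (𝟙 ⊕ X)) n  ∎
  where
  open ≡-Reasoning
  F = genP (dPattern 3)
  same-denominator : coeff (1-x ^ᴾ 2 ⊗ 1-x-x² ^ᴾ 0) ≗ coeff (1-x ^ᴾ 2)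
  same-denominator 0 = refl
  same-denominator 1 = refl
  same-denominator 2 = refl
  same-denominator (suc (suc (suc _))) = refl
  same-numerator : coeff (numerator 0) ≗ coeff (1-x-x² ⊗ 1-x ⊕ X ⊗ (𝟙 ⊕ X))
  same-numerator 0 = refl
  same-numerator 1 = refl
  same-numerator 2 = refl
  same-numerator 3 = refl
  same-numerator (suc (suc (suc (suc _)))) = refl

mainTheorem5 :
    -- (i)  P_{132,21}(x) = 1/(1-x)
    (genP (2 ∷ 1 ∷ []) ≡N/D (𝟙 , 𝟙 ⊕ negP X))
    ×
    -- (ii) P_{132,312}(x) = ((1-x-x²)(1-x) + x(1+x)) / (1-x)²
    (genP (3 ∷ 1 ∷ 2 ∷ [])
       ≡N/D ( (𝟙 ⊕ negP X ⊕ negP (X ^ᴾ 2)) ⊗ (𝟙 ⊕ negP X) ⊕ X ⊗ (𝟙 ⊕ X)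
            , (𝟙 ⊕ negP X) ^ᴾ 2 ))
    ×
    -- (iii) for d ≥ 4 and τ = d 1 2 … (d-1)
    (∀ (d : ℕ) → 4 ≤ d →
      genP (dPattern d)
        ≡N/D ( (𝟙 ⊕ negP X) ⊗ (𝟙 ⊕ negP X ⊕ negP (X ^ᴾ 2)) ^ᴾ (d ∸ 2)
               ⊕ (𝟙 ⊕ negP (X ^ᴾ 2))
                 ⊗ sumP (d ∸ 3)
                     (λ r → (𝟙 ⊕ negP X ⊕ negP (X ^ᴾ 2)) ^ᴾ (r + 1) ⊗ X ^ᴾ (d ∸ 3 ∸ r))
               ⊕ X ^ᴾ (d ∸ 2) ⊗ (𝟙 ⊕ X)
             , (𝟙 ⊕ negP X) ^ᴾ 2 ⊗ (𝟙 ⊕ negP X ⊕ negP (X ^ᴾ 2)) ^ᴾ (d ∸ 3) ))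
mainTheorem5 = gf-21 , gf-312 , λ { _ (s≤s (s≤s (s≤s (s≤s (z≤n {k}))))) → gf-dPattern (suc k) }
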